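{- For every $n\ge 4$, the number $|A^{3412}_{3412}(2n)|$ equals $(2n)!$ times the coefficient of $x^{2n}$ in $(4x^2-12x\sin x+9)\sec x$.
   Context: A permutation $\sigma$ of $\{1,\dots,m\}$ is alternating if $\sigma_1<\sigma_2>\sigma_3<\sigma_4>\cdots$; $A_m$ is the set of such permutations. For $P,Q\in A_4$ and $m\ge 8$ even, $A^{P}_{Q}(m)$ denotes the set of $\sigma\in A_m$ whose prefix $\sigma_1\sigma_2\sigma_3\sigma_4$ is order-isomorphic to $P$ and whose suffix $\sigma_{m-3}\sigma_{m-2}\sigma_{m-1}\sigma_m$ is order-isomorphic to $Q$ (order-isomorphic means having entries in the same relative order). Thus $A^{3412}_{3412}(m)$ consists of the $\sigma\in A_m$ with $\sigma_3<\sigma_4<\sigma_1<\sigma_2$ and $\sigma_{m-1}<\sigma_m<\sigma_{m-3}<\sigma_{m-2}$. -}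

module Defs where

open import Data.Bool using (Bool; true; false; _∧_; not; if_then_else_)
open import Data.Nat as ℕ using (ℕ; zero; suc; _∸_; _!; _<ᵇ_)
open import Data.Nat.Properties using (_!≢0)
open import Data.Integer as ℤ using (ℤ)
open import Data.Rational as ℚ using (ℚ)
open import Data.Fin using (Fin; toℕ)
open import Data.Fin.Properties using () renaming (_≟_ to _≟ᶠ_)
open import Data.List using (List; []; _∷_; map; concatMap; length; take; drop; allFin; upTo; zipWith)
open import Data.Vec as Vec using (Vec; toList)
open import Relation.Nullary.Decidable using (does)

-- A permutation σ of {1,…,m} is represented (all entries shifted down
-- by one) as a word σ₁…σₘ over Fin m = {0,…,m-1} with pairwise distinct
-- entries.  Everything below depends only on relative order.

allWords : (m k : ℕ) → List (Vec (Fin m) k)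
allWords m zero    = Vec.[] ∷ []
allWords m (suc k) = concatMap (λ a → map (a Vec.∷_) (allWords m k)) (allFin m)

countᵇ : {A : Set} → (A → Bool) → List A → ℕ
countᵇ p []       = 0
countᵇ p (x ∷ xs) = if p x then suc (countᵇ p xs) else countᵇ p xs

allᵇ : {A : Set} → (A → Bool) → List A → Bool
allᵇ p []       = true
allᵇ p (x ∷ xs) = p x ∧ allᵇ p xs

distinct : {m : ℕ} → List (Fin m) → Bool
distinct []       = true
distinct (a ∷ as) = allᵇ (λ b → not (does (a ≟ᶠ b))) as ∧ distinct as

_==ᵇ_ : Bool → Bool → Bool
true  ==ᵇ b = b
false ==ᵇ b = not b

altFrom : Bool → List ℕ → Bool
altFrom up []           = true
altFrom up (x ∷ [])     = true
altFrom true  (x ∷ y ∷ xs) = (x <ᵇ y) ∧ altFrom false (y ∷ xs)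
altFrom false (x ∷ y ∷ xs) = (y <ᵇ x) ∧ altFrom true  (y ∷ xs)

isAlternating : List ℕ → Bool
isAlternating = altFrom true

orderIso : List ℕ → List ℕ → Bool
orderIso []       []       = true
orderIso []       (_ ∷ _)  = false
orderIso (_ ∷ _)  []       = false
orderIso (x ∷ xs) (y ∷ ys) =
  sameLen xs ys ∧
  allᵇ (λ p → ((x <ᵇ proj₁' p) ==ᵇ (y <ᵇ proj₂' p)) ∧ ((proj₁' p <ᵇ x) ==ᵇ (proj₂' p <ᵇ y)))
       (zipWith pair xs ys)
  ∧ orderIso xs ys
  where
  data Pair : Set where
    pair : ℕ → ℕ → Pair
  proj₁' : Pair → ℕ
  proj₁' (pair a _) = a
  proj₂' : Pair → ℕ
  proj₂' (pair _ b) = b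
  sameLen : List ℕ → List ℕ → Bool
  sameLen []       []       = true
  sameLen (_ ∷ as) (_ ∷ bs) = sameLen as bs
  sameLen _        _        = false

p3412 : List ℕ
p3412 = 3 ∷ 4 ∷ 1 ∷ 2 ∷ []

inAPQ : (m : ℕ) → List ℕ → List ℕ → Vec (Fin m) m → Bool
inAPQ m P Q σ =
  distinct (toList σ) ∧ isAlternating w ∧
  orderIso (take 4 w) P ∧ orderIso (drop (m ∸ 4) w) Q
  where
  w = map toℕ (toList σ)

cardAPQ : (m : ℕ) → List ℕ → List ℕ → ℕ
cardAPQ m P Q = countᵇ (inAPQ m P Q) (allWords m m)

Series : Set
Series = ℕ → ℚ

sumℚ : List ℚ → ℚ
sumℚ []       = ℚ.0ℚ
sumℚ (q ∷ qs) = q ℚ.+ sumℚ qs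

invFact : ℕ → ℚ
invFact k = (ℤ.+ 1 ℚ./ (k !)) {{k !≢0}}

_⊛_ : Series → Series → Series
(f ⊛ g) k = sumℚ (map (λ i → f i ℚ.* g (k ∸ i)) (upTo (suc k)))

_⊕_ : Series → Series → Series
(f ⊕ g) k = f k ℚ.+ g k

_·ₛ_ : ℚ → Series → Series
(c ·ₛ f) k = c ℚ.* f k

constS : ℚ → Series
constS c zero    = c
constS c (suc _) = ℚ.0ℚ

xS : Series
xS 1 = ℚ.1ℚ
xS _ = ℚ.0ℚ

sgn : ℕ → ℚ
sgn zero    = ℚ.1ℚ
sgn (suc j) = ℚ.- sgn j

isEven : ℕ → Bool
isEven zero    = true
isEven (suc k) = not (isEven k)

sinS : Series
sinS k = if isEven k then ℚ.0ℚ else sgn ℕ.⌊ k /2⌋ ℚ.* invFact k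

cosS : Series
cosS k = if isEven k then sgn ℕ.⌊ k /2⌋ ℚ.* invFact k else ℚ.0ℚ

-- Multiplicative inverse of a series f with constant term 1:
-- g₀ = 1,  g_k = - Σ_{j=1}^{k} f_j g_{k-j}  (k ≥ 1), so that f·g = 1.
-- invRev f k = [g_k, g_{k-1}, …, g_0]
invRev : Series → ℕ → List ℚ
invRev f zero    = ℚ.1ℚ ∷ []
invRev f (suc k) = new ∷ prev
  where
  prev = invRev f k
  new  = ℚ.- sumℚ (zipWith ℚ._*_ (map (λ j → f (suc j)) (upTo (suc k))) prev)

invS : Series → Series
invS f k with invRev f k
... | []    = ℚ.0ℚ
... | g ∷ _ = g

secS : Series
secS = invS cosS

targetS : Series
targetS =
  ((((ℤ.+ 4 ℚ./ 1) ·ₛ (xS ⊛ xS)) ⊕ ((ℚ.- (ℤ.+ 12 ℚ./ 1)) ·ₛ (xS ⊛ sinS)))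
     ⊕ constS (ℤ.+ 9 ℚ./ 1)) ⊛ secS

-- Write E(n) for the number of alternating permutations of length n. Deleting the first entry of
-- a permutation and standardising the rest turns every count of alternating permutations that
-- continue a prescribed first step into a sum over that entry. Expanding the first three entries
-- shows, for any condition R on the last few entries, that
--   #(up-down with σ₄ < σ₁) + 3·#(up-down) = 2m·#(down-up of length m - 1),
-- everything counted subject to R; for up-down permutations σ₄ < σ₁ says exactly that the prefix is
-- order-isomorphic to 3412. Taking R = "suffix 3412" and R = "no condition", and using that
-- reverse-complement exchanges prefix and suffix 3412, leaves only Euler numbers:
--   |A^{3412}_{3412}(m)| = 4m(m-1) E(m-2) - 12m E(m-1) + 9 E(m).
-- On the series side, the recursion over the first entry is solved by binomial sums weighted with
-- the Taylor coefficients of cos and sin. This shows that E(n)/n! is the n-th coefficient of sec x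
-- for even n and of sin x · sec x for odd n (André's theorem), and multiplying out
-- (4x² - 12x sin x + 9) sec x gives the same combination.

module Submission where

open import Algebra.Bundles using (Semiring; CommutativeRing)
open import Data.Fin.Base using (toℕ)
open import Data.Fin.Properties using (toℕ<n)
open import Data.Nat.Base using (ℕ; zero; suc; _<_)
open import Function.Base using (_∘_)
import Relation.Binary.PropositionalEquality as ≡
open import Relation.Binary.PropositionalEquality using (_≡_)

-- Sums over initial segments of ℕ

module RangeSum {c ℓ} (R : Semiring c ℓ) where

  open Semiring R
  import Algebra.Properties.Semiring.Sum R as Fin∑
  open import Relation.Binary.Reasoning.Setoid setoid

  ∑ : ℕ → (ℕ → Carrier) → Carrier
  ∑ zero    f = 0#
  ∑ (suc n) f = f 0 + ∑ n (f ∘ suc)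

  syntax ∑ n (λ i → x) = ∑[ i < n ] x

  ∑≡sum : ∀ n (f : ℕ → Carrier) → ∑ n f ≡ Fin∑.sum {n} (f ∘ toℕ)
  ∑≡sum zero    f = ≡.refl
  ∑≡sum (suc n) f = ≡.cong (f 0 +_) (∑≡sum n (f ∘ suc))

  ∑-cong : ∀ n {f g : ℕ → Carrier} → (∀ i → i < n → f i ≈ g i) → ∑ n f ≈ ∑ n g
  ∑-cong n {f} {g} f≈g = begin
    ∑ n f                ≡⟨ ∑≡sum n f ⟩
    Fin∑.sum {n} (f ∘ toℕ) ≈⟨ Fin∑.sum-cong-≋ {n} (λ i → f≈g (toℕ i) (toℕ<n i)) ⟩
    Fin∑.sum {n} (g ∘ toℕ) ≡⟨ ∑≡sum n g ⟨
    ∑ n g                ∎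

  ∑-distrib-+ : ∀ n (f g : ℕ → Carrier) → ∑[ i < n ] (f i + g i) ≈ ∑ n f + ∑ n g
  ∑-distrib-+ n f g = begin
    ∑[ i < n ] (f i + g i)                      ≡⟨ ∑≡sum n (λ i → f i + g i) ⟩
    Fin∑.sum {n} (λ i → f (toℕ i) + g (toℕ i)) ≈⟨ Fin∑.∑-distrib-+ {n} (f ∘ toℕ) (g ∘ toℕ) ⟩
    Fin∑.sum {n} (f ∘ toℕ) + Fin∑.sum {n} (g ∘ toℕ) ≡⟨ ≡.cong₂ _+_ (∑≡sum n f) (∑≡sum n g) ⟨
    ∑ n f + ∑ n g                               ∎

  ∑-swap : ∀ m n (f : ℕ → ℕ → Carrier) → ∑[ i < m ] ∑[ j < n ] f i j ≈ ∑[ j < n ] ∑[ i < m ] f i j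
  ∑-swap m n f = begin
    ∑[ i < m ] ∑[ j < n ] f i j
      ≡⟨ ≡.trans (∑≡sum m (λ i → ∑[ j < n ] f i j)) (Fin∑.sum-cong-≗ {m} (λ i → ∑≡sum n (f (toℕ i)))) ⟩
    Fin∑.sum {m} (λ i → Fin∑.sum {n} (λ j → f (toℕ i) (toℕ j)))
      ≈⟨ Fin∑.∑-comm {m} {n} (λ i j → f (toℕ i) (toℕ j)) ⟩
    Fin∑.sum {n} (λ j → Fin∑.sum {m} (λ i → f (toℕ i) (toℕ j)))
      ≡⟨ ≡.trans (∑≡sum n (λ j → ∑[ i < m ] f i j)) (Fin∑.sum-cong-≗ {n} (λ j → ∑≡sum m (λ i → f i (toℕ j)))) ⟨
    ∑[ j < n ] ∑[ i < m ] f i j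
      ∎

  *-distribˡ-∑ : ∀ n x (f : ℕ → Carrier) → x * ∑ n f ≈ ∑[ i < n ] (x * f i)
  *-distribˡ-∑ zero    x f = zeroʳ x
  *-distribˡ-∑ (suc n) x f = trans (distribˡ x (f 0) _) (+-congˡ (*-distribˡ-∑ n x (f ∘ suc)))

  *-distribʳ-∑ : ∀ n x (f : ℕ → Carrier) → ∑ n f * x ≈ ∑[ i < n ] (f i * x)
  *-distribʳ-∑ zero    x f = zeroˡ x
  *-distribʳ-∑ (suc n) x f = trans (distribʳ x (f 0) _) (+-congˡ (*-distribʳ-∑ n x (f ∘ suc)))

  ∑-zero : ∀ n → ∑[ i < n ] 0# ≈ 0#
  ∑-zero zero    = refl
  ∑-zero (suc n) = trans (+-identityˡ _) (∑-zero n)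

  ∑-snoc : ∀ n (f : ℕ → Carrier) → ∑ (suc n) f ≈ ∑ n f + f n
  ∑-snoc zero    f = trans (+-comm (f 0) 0#) (+-congʳ (sym (∑-zero 0)))
  ∑-snoc (suc n) f = trans (+-congˡ (∑-snoc n (f ∘ suc))) (sym (+-assoc (f 0) _ _))

open import Defs
open import Data.Bool using (Bool; true; false; _∧_; not; T; if_then_else_)
open import Data.Bool.Properties using (T-≡; ∧-assoc; ∧-comm; ∧-zeroʳ; ∧-identityʳ; not-involutive; not-injective)
open import Data.Empty using (⊥-elim)
open import Data.Fin as Fin using (Fin; opposite; punchIn)
open import Data.Fin.Permutation using (permutation)
open import Data.Fin.Properties using (opposite-involutive; opposite-prop; punchIn-injective; punchInᵢ≢i) renaming (_≟_ to _≟ᶠ_)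
open import Data.Integer as ℤ using (ℤ; +_; -[1+_]; +[1+_])
import Data.Integer.Properties as ℤₚ
import Data.Integer.Tactic.RingSolver as ℤ-Ring
open import Data.List as List using (List; []; _∷_; _++_; [_]; take; drop; length; concatMap; tabulate; applyUpTo; upTo; zipWith)
open import Data.List.Properties using (unfold-reverse; reverse-map; length-map; length-reverse; map-upTo)
open import Data.List.Relation.Unary.All using (All; []; _∷_)
open import Data.Nat as ℕ using (_+_; _*_; _∸_; _≤_; _<ᵇ_; _⊓_; z≤n; s≤s; _!)
open import Data.Nat.Coprimality as Coprime using (1-coprimeTo)
open import Data.Nat.GeneralisedArithmetic using (iterate)
open import Data.Nat.Properties as ℕₚ using (<ᵇ⇒<; <⇒<ᵇ; ≮⇒≥; +-identityʳ; m≤n⇒m⊓n≡m; m≥n⇒m⊓n≡n; ≤-trans; <-trans; <⇒≤; ≤-pred; m≤n⇒m≤1+n; m∸n≤m)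
import Data.Nat.Tactic.RingSolver as ℕ-Ring
open import Data.Rational as ℚ using (ℚ; mkℚ; _/_; 0ℚ; 1ℚ) renaming (_*_ to _*ℚ_)
import Data.Rational.Properties as ℚₚ
open import Data.Rational.Solver using () renaming (module +-*-Solver to ℚ-Solver)
open import Data.Sum using (_⊎_; inj₁; inj₂)
open import Data.Vec as Vec using (Vec; []; _∷_; _∷ʳ_; toList)
open import Data.Vec.Properties using (toList-map; toList-reverse; reverse-∷)
open import Function using (id)
open import Function.Bundles using (Equivalence)
open import Function.Definitions using (Injective)
open import Relation.Binary.PropositionalEquality using (_≡_; _≢_; _≗_; refl; sym; trans; cong; cong₂; subst; module ≡-Reasoning)
open import Relation.Nullary using (yes; no; contradiction)
open import Relation.Nullary.Decidable using (does; dec-true; dec-false)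
import Algebra.Properties.Semiring.Sum ℕₚ.+-*-semiring as Fin∑

module ℕΣ = RangeSum ℕₚ.+-*-semiring
module ℤΣ = RangeSum ℤₚ.+-*-semiring
module ℚΣ = RangeSum (CommutativeRing.semiring ℚₚ.+-*-commutativeRing)

<ᵇ≡true⇒< : ∀ m n → (m <ᵇ n) ≡ true → m < n
<ᵇ≡true⇒< m n eq = <ᵇ⇒< m n (Equivalence.from T-≡ eq)

<ᵇ≡false⇒≥ : ∀ m n → (m <ᵇ n) ≡ false → n ≤ m
<ᵇ≡false⇒≥ m n eq = ≮⇒≥ (λ m<n → subst T eq (<⇒<ᵇ m<n))

<⇒<ᵇ≡true : ∀ {m n} → m < n → (m <ᵇ n) ≡ true
<⇒<ᵇ≡true m<n = Equivalence.to T-≡ (<⇒<ᵇ m<n)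

≥⇒<ᵇ≡false : ∀ {m n} → n ≤ m → (m <ᵇ n) ≡ false
≥⇒<ᵇ≡false {m} {n} n≤m with m <ᵇ n in eq
... | false = refl
... | true  = contradiction (<ᵇ≡true⇒< m n eq) (ℕₚ.≤⇒≯ n≤m)

𝟙 : Bool → ℕ
𝟙 true  = 1
𝟙 false = 0

𝟙-∧ : ∀ a b → 𝟙 (a ∧ b) ≡ 𝟙 a * 𝟙 b
𝟙-∧ true  b = sym (+-identityʳ (𝟙 b))
𝟙-∧ false b = refl

𝟙-not : ∀ b → 𝟙 (not b) + 𝟙 b ≡ 1
𝟙-not true  = refl
𝟙-not false = refl

∑-truncate : ∀ n t (f : ℕ → ℕ) → ℕΣ.∑[ x < n ] (𝟙 (x <ᵇ t) * f x) ≡ ℕΣ.∑ (n ⊓ t) f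
∑-truncate zero    t f = refl
∑-truncate (suc n) t f with n <ᵇ t in eq
... | true  = begin
  ℕΣ.∑[ x < suc n ] (𝟙 (x <ᵇ t) * f x)      ≡⟨ ℕΣ.∑-snoc n (λ x → 𝟙 (x <ᵇ t) * f x) ⟩
  ℕΣ.∑[ x < n ] (𝟙 (x <ᵇ t) * f x) + 𝟙 (n <ᵇ t) * f n ≡⟨ cong₂ _+_ (∑-truncate n t f) (cong (λ b → 𝟙 b * f n) eq) ⟩
  ℕΣ.∑ (n ⊓ t) f + 1 * f n                 ≡⟨ cong₂ (λ k y → ℕΣ.∑ k f + y) (m≤n⇒m⊓n≡m (<⇒≤ n<t)) (ℕₚ.*-identityˡ (f n)) ⟩
  ℕΣ.∑ n f + f n                           ≡⟨ ℕΣ.∑-snoc n f ⟨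
  ℕΣ.∑ (suc n) f                           ≡⟨ cong (λ k → ℕΣ.∑ k f) (m≤n⇒m⊓n≡m n<t) ⟨
  ℕΣ.∑ (suc n ⊓ t) f                       ∎
  where open ≡-Reasoning
        n<t = <ᵇ≡true⇒< n t eq
... | false = begin
  ℕΣ.∑[ x < suc n ] (𝟙 (x <ᵇ t) * f x)      ≡⟨ ℕΣ.∑-snoc n (λ x → 𝟙 (x <ᵇ t) * f x) ⟩
  ℕΣ.∑[ x < n ] (𝟙 (x <ᵇ t) * f x) + 𝟙 (n <ᵇ t) * f n ≡⟨ cong₂ _+_ (∑-truncate n t f) (cong (λ b → 𝟙 b * f n) eq) ⟩
  ℕΣ.∑ (n ⊓ t) f + 0                       ≡⟨ +-identityʳ _ ⟩
  ℕΣ.∑ (n ⊓ t) f                           ≡⟨ cong (λ k → ℕΣ.∑ k f) (trans (m≥n⇒m⊓n≡n t≤n) (sym (m≥n⇒m⊓n≡n (m≤n⇒m≤1+n t≤n)))) ⟩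
  ℕΣ.∑ (suc n ⊓ t) f                       ∎
  where open ≡-Reasoning
        t≤n = <ᵇ≡false⇒≥ n t eq

∑𝟙<ᵇ : ∀ n t → ℕΣ.∑[ x < n ] 𝟙 (x <ᵇ t) ≡ n ⊓ t
∑𝟙<ᵇ n t = begin
  ℕΣ.∑[ x < n ] 𝟙 (x <ᵇ t)            ≡⟨ ℕΣ.∑-cong n (λ x _ → sym (ℕₚ.*-identityʳ (𝟙 (x <ᵇ t)))) ⟩
  ℕΣ.∑[ x < n ] (𝟙 (x <ᵇ t) * 1)      ≡⟨ ∑-truncate n t (λ _ → 1) ⟩
  ℕΣ.∑[ x < n ⊓ t ] 1                 ≡⟨ ∑1 (n ⊓ t) ⟩
  n ⊓ t                               ∎
  where
  open ≡-Reasoning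
  ∑1 : ∀ k → ℕΣ.∑[ x < k ] 1 ≡ k
  ∑1 zero    = refl
  ∑1 (suc k) = cong suc (∑1 k)

-- Counting words and injective words

countᵇ-++ : ∀ {A : Set} (p : A → Bool) xs ys → countᵇ p (xs ++ ys) ≡ countᵇ p xs + countᵇ p ys
countᵇ-++ p []       ys = refl
countᵇ-++ p (x ∷ xs) ys with p x
... | true  = cong suc (countᵇ-++ p xs ys)
... | false = countᵇ-++ p xs ys

countᵇ-map : ∀ {A B : Set} (p : B → Bool) (f : A → B) xs → countᵇ p (List.map f xs) ≡ countᵇ (p ∘ f) xs
countᵇ-map p f []       = refl
countᵇ-map p f (x ∷ xs) with p (f x)
... | true  = cong suc (countᵇ-map p f xs)
... | false = countᵇ-map p f xs

countᵇ-cong : ∀ {A : Set} {p q : A → Bool} → p ≗ q → ∀ xs → countᵇ p xs ≡ countᵇ q xs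
countᵇ-cong p≗q []       = refl
countᵇ-cong {q = q} p≗q (x ∷ xs) rewrite p≗q x with q x
... | true  = cong suc (countᵇ-cong p≗q xs)
... | false = countᵇ-cong p≗q xs

countᵇ-concatMap-tabulate : ∀ {A B : Set} n (p : A → Bool) (g : B → List A) (f : Fin n → B) →
  countᵇ p (concatMap g (tabulate f)) ≡ Fin∑.sum (λ i → countᵇ p (g (f i)))
countᵇ-concatMap-tabulate zero    p g f = refl
countᵇ-concatMap-tabulate (suc n) p g f =
  trans (countᵇ-++ p (g (f Fin.zero)) _)
        (cong (_+_ (countᵇ p (g (f Fin.zero)))) (countᵇ-concatMap-tabulate n p g (f ∘ Fin.suc)))

countWords : (N k : ℕ) → (Vec (Fin N) k → Bool) → ℕ
countWords N k P = countᵇ P (allWords N k)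

countWords-cong : ∀ N k {P Q : Vec (Fin N) k → Bool} → P ≗ Q → countWords N k P ≡ countWords N k Q
countWords-cong N k P≗Q = countᵇ-cong P≗Q (allWords N k)

countWords-∧ : ∀ N k b (P : Vec (Fin N) k → Bool) → countWords N k (λ w → b ∧ P w) ≡ 𝟙 b * countWords N k P
countWords-∧ N k true  P = sym (+-identityʳ _)
countWords-∧ N k false P = none (allWords N k)
  where
  none : ∀ {A : Set} (xs : List A) → countᵇ (λ _ → false) xs ≡ 0
  none []       = refl
  none (_ ∷ xs) = none xs

countWords-cons : ∀ N k (P : Vec (Fin N) (suc k) → Bool) →
  countWords N (suc k) P ≡ Fin∑.sum (λ a → countWords N k (P ∘ (a ∷_)))
countWords-cons N k P =
  trans (countᵇ-concatMap-tabulate N P (λ a → List.map (a ∷_) (allWords N k)) id)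
        (Fin∑.sum-cong-≗ (λ a → countᵇ-map P (a ∷_) (allWords N k)))

countWords-snoc : ∀ N k (P : Vec (Fin N) (suc k) → Bool) →
  countWords N (suc k) P ≡ Fin∑.sum (λ a → countWords N k (λ w → P (w ∷ʳ a)))
countWords-snoc N zero    P = countWords-cons N zero P
countWords-snoc N (suc k) P = begin
  countWords N (suc (suc k)) P                                           ≡⟨ countWords-cons N (suc k) P ⟩
  Fin∑.sum (λ a → countWords N (suc k) (P ∘ (a ∷_)))                     ≡⟨ Fin∑.sum-cong-≗ (λ a → countWords-snoc N k (P ∘ (a ∷_))) ⟩
  Fin∑.sum (λ a → Fin∑.sum (λ b → countWords N k (λ w → P (a ∷ (w ∷ʳ b))))) ≡⟨ Fin∑.∑-comm (λ a b → countWords N k (λ w → P (a ∷ (w ∷ʳ b)))) ⟩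
  Fin∑.sum (λ b → Fin∑.sum (λ a → countWords N k (λ w → P (a ∷ (w ∷ʳ b))))) ≡⟨ Fin∑.sum-cong-≗ (λ b → countWords-cons N k (λ w → P (w ∷ʳ b))) ⟨
  Fin∑.sum (λ b → countWords N (suc k) (λ w → P (w ∷ʳ b)))               ∎
  where open ≡-Reasoning

countWords-reverse : ∀ N k (P : Vec (Fin N) k → Bool) → countWords N k (P ∘ Vec.reverse) ≡ countWords N k P
countWords-reverse N zero    P = refl
countWords-reverse N (suc k) P = begin
  countWords N (suc k) (P ∘ Vec.reverse)                     ≡⟨ countWords-cons N k (P ∘ Vec.reverse) ⟩
  Fin∑.sum (λ a → countWords N k (P ∘ Vec.reverse ∘ (a ∷_)))  ≡⟨ Fin∑.sum-cong-≗ (λ a → countWords-cong N k (λ w → cong P (reverse-∷ a w))) ⟩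
  Fin∑.sum (λ a → countWords N k (λ w → P (Vec.reverse w ∷ʳ a))) ≡⟨ Fin∑.sum-cong-≗ (λ a → countWords-reverse N k (λ u → P (u ∷ʳ a))) ⟩
  Fin∑.sum (λ a → countWords N k (λ u → P (u ∷ʳ a)))          ≡⟨ countWords-snoc N k P ⟨
  countWords N (suc k) P                                     ∎
  where open ≡-Reasoning

countWords-opposite : ∀ N k (P : Vec (Fin N) k → Bool) → countWords N k (P ∘ Vec.map opposite) ≡ countWords N k P
countWords-opposite N zero    P = refl
countWords-opposite N (suc k) P = begin
  countWords N (suc k) (P ∘ Vec.map opposite)                           ≡⟨ countWords-cons N k (P ∘ Vec.map opposite) ⟩
  Fin∑.sum (λ a → countWords N k (P ∘ Vec.map opposite ∘ (a ∷_)))        ≡⟨ Fin∑.sum-cong-≗ (λ a → countWords-opposite N k (P ∘ (opposite a ∷_))) ⟩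
  Fin∑.sum (λ a → countWords N k (P ∘ (opposite a ∷_)))                  ≡⟨ Fin∑.∑-permute (λ a → countWords N k (P ∘ (a ∷_))) reversal ⟨
  Fin∑.sum (λ a → countWords N k (P ∘ (a ∷_)))                           ≡⟨ countWords-cons N k P ⟨
  countWords N (suc k) P                                                ∎
  where
  open ≡-Reasoning
  reversal = permutation opposite opposite opposite-involutive opposite-involutive

notIn : ∀ {N} → Fin N → List (Fin N) → Bool
notIn a = allᵇ (λ b → not (does (a ≟ᶠ b)))

countWords-notIn : ∀ N k (a : Fin (suc N)) (P : Vec (Fin (suc N)) k → Bool) →
  countWords (suc N) k (λ w → notIn a (toList w) ∧ P w) ≡ countWords N k (P ∘ Vec.map (punchIn a))
countWords-notIn N zero    a P = refl
countWords-notIn N (suc k) a P = begin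
  countWords (suc N) (suc k) (λ w → notIn a (toList w) ∧ P w)  ≡⟨ countWords-cons (suc N) k _ ⟩
  Fin∑.sum t                                                  ≡⟨ Fin∑.sum-remove {i = a} t ⟩
  t a + Fin∑.sum (t ∘ punchIn a)                              ≡⟨ cong₂ _+_ t[a]≡0 (Fin∑.sum-cong-≗ t∘punchIn) ⟩
  Fin∑.sum (λ c → countWords N k (λ v → P (punchIn a c ∷ Vec.map (punchIn a) v))) ≡⟨ countWords-cons N k (P ∘ Vec.map (punchIn a)) ⟨
  countWords N (suc k) (P ∘ Vec.map (punchIn a))              ∎
  where
  open ≡-Reasoning
  t : Fin (suc N) → ℕ
  t b = countWords (suc N) k (λ w → notIn a (toList (b ∷ w)) ∧ P (b ∷ w))
  t[a]≡0 : t a ≡ 0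
  t[a]≡0 = trans (countWords-cong (suc N) k (λ w → cong (λ z → (not z ∧ notIn a (toList w)) ∧ P (a ∷ w)) (dec-true (a ≟ᶠ a) refl)))
                 (countWords-∧ (suc N) k false (λ _ → true))
  t∘punchIn : ∀ c → t (punchIn a c) ≡ countWords N k (λ v → P (punchIn a c ∷ Vec.map (punchIn a) v))
  t∘punchIn c = trans
    (countWords-cong (suc N) k (λ w → cong (λ z → (not z ∧ notIn a (toList w)) ∧ P (punchIn a c ∷ w))
                                          (dec-false (a ≟ᶠ punchIn a c) (punchInᵢ≢i a c ∘ sym))))
    (countWords-notIn N k a (P ∘ (punchIn a c ∷_)))

allᵇ-cong : ∀ {A : Set} {p q : A → Bool} → p ≗ q → ∀ xs → allᵇ p xs ≡ allᵇ q xs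
allᵇ-cong p≗q []       = refl
allᵇ-cong p≗q (x ∷ xs) = cong₂ _∧_ (p≗q x) (allᵇ-cong p≗q xs)

allᵇ-map : ∀ {A B : Set} (p : B → Bool) (f : A → B) xs → allᵇ p (List.map f xs) ≡ allᵇ (p ∘ f) xs
allᵇ-map p f []       = refl
allᵇ-map p f (x ∷ xs) = cong (p (f x) ∧_) (allᵇ-map p f xs)

allᵇ-++ : ∀ {A : Set} (p : A → Bool) xs ys → allᵇ p (xs ++ ys) ≡ allᵇ p xs ∧ allᵇ p ys
allᵇ-++ p []       ys = refl
allᵇ-++ p (x ∷ xs) ys = trans (cong (p x ∧_) (allᵇ-++ p xs ys)) (sym (∧-assoc (p x) _ _))

allᵇ-reverse : ∀ {A : Set} (p : A → Bool) xs → allᵇ p (List.reverse xs) ≡ allᵇ p xs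
allᵇ-reverse p []       = refl
allᵇ-reverse p (x ∷ xs) = begin
  allᵇ p (List.reverse (x ∷ xs))        ≡⟨ cong (allᵇ p) (unfold-reverse x xs) ⟩
  allᵇ p (List.reverse xs ++ [ x ])     ≡⟨ allᵇ-++ p (List.reverse xs) [ x ] ⟩
  allᵇ p (List.reverse xs) ∧ (p x ∧ true) ≡⟨ cong₂ _∧_ (allᵇ-reverse p xs) (∧-identityʳ (p x)) ⟩
  allᵇ p xs ∧ p x                       ≡⟨ ∧-comm (allᵇ p xs) (p x) ⟩
  allᵇ p (x ∷ xs)                       ∎
  where open ≡-Reasoning

does-≟-injective : ∀ {M N} (f : Fin M → Fin N) → Injective _≡_ _≡_ f →
  ∀ x y → does (f x ≟ᶠ f y) ≡ does (x ≟ᶠ y)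
does-≟-injective f inj x y with x ≟ᶠ y
... | yes refl = dec-true (f x ≟ᶠ f x) refl
... | no x≢y   = dec-false (f x ≟ᶠ f y) (x≢y ∘ inj)

does-≟-sym : ∀ {N} (x y : Fin N) → does (x ≟ᶠ y) ≡ does (y ≟ᶠ x)
does-≟-sym x y with x ≟ᶠ y
... | yes refl = sym (dec-true (x ≟ᶠ x) refl)
... | no x≢y   = sym (dec-false (y ≟ᶠ x) (x≢y ∘ sym))

distinct-map : ∀ {M N} (f : Fin M → Fin N) → Injective _≡_ _≡_ f →
  ∀ xs → distinct (List.map f xs) ≡ distinct xs
distinct-map f inj []       = refl
distinct-map f inj (x ∷ xs) = cong₂ _∧_
  (trans (allᵇ-map _ f xs) (allᵇ-cong (λ y → cong not (does-≟-injective f inj x y)) xs))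
  (distinct-map f inj xs)

distinct-snoc : ∀ {N} (xs : List (Fin N)) y → distinct (xs ++ [ y ]) ≡ notIn y xs ∧ distinct xs
distinct-snoc []       y = refl
distinct-snoc (x ∷ xs) y = begin
  notIn x (xs ++ [ y ]) ∧ distinct (xs ++ [ y ])               ≡⟨ cong₂ _∧_ (allᵇ-++ _ xs [ y ]) (distinct-snoc xs y) ⟩
  (notIn x xs ∧ (x≢y ∧ true)) ∧ (notIn y xs ∧ distinct xs)      ≡⟨ cong (λ b → (notIn x xs ∧ b) ∧ _) (trans (∧-identityʳ x≢y) (cong not (does-≟-sym x y))) ⟩
  (notIn x xs ∧ y≢x) ∧ (notIn y xs ∧ distinct xs)               ≡⟨ shuffle (notIn x xs) y≢x (notIn y xs) (distinct xs) ⟩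
  (y≢x ∧ notIn y xs) ∧ (notIn x xs ∧ distinct xs)               ∎
  where
  open ≡-Reasoning
  x≢y = not (does (x ≟ᶠ y))
  y≢x = not (does (y ≟ᶠ x))
  shuffle : ∀ a b c d → (a ∧ b) ∧ (c ∧ d) ≡ (b ∧ c) ∧ (a ∧ d)
  shuffle true  true  c d = refl
  shuffle true  false c d = refl
  shuffle false b     c d = sym (∧-zeroʳ (b ∧ c))

distinct-reverse : ∀ {N} (xs : List (Fin N)) → distinct (List.reverse xs) ≡ distinct xs
distinct-reverse []       = refl
distinct-reverse (x ∷ xs) = begin
  distinct (List.reverse (x ∷ xs))                     ≡⟨ cong distinct (unfold-reverse x xs) ⟩
  distinct (List.reverse xs ++ [ x ])                  ≡⟨ distinct-snoc (List.reverse xs) x ⟩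
  notIn x (List.reverse xs) ∧ distinct (List.reverse xs) ≡⟨ cong₂ _∧_ (allᵇ-reverse _ xs) (distinct-reverse xs) ⟩
  distinct (x ∷ xs)                                    ∎
  where open ≡-Reasoning

values : ∀ {N k} → Vec (Fin N) k → List ℕ
values w = List.map toℕ (toList w)

countInjective : (N k : ℕ) → (List ℕ → Bool) → ℕ
countInjective N k Q = countWords N k (λ w → distinct (toList w) ∧ Q (values w))

countInjective-cong : ∀ N k (Q Q′ : List ℕ → Bool) → (∀ (w : Vec (Fin N) k) → Q (values w) ≡ Q′ (values w)) →
  countInjective N k Q ≡ countInjective N k Q′
countInjective-cong N k Q Q′ Q≡Q′ = countWords-cong N k (λ w → cong (distinct (toList w) ∧_) (Q≡Q′ w))

countInjective-∧ : ∀ N k b (Q : List ℕ → Bool) → countInjective N k (λ ys → b ∧ Q ys) ≡ 𝟙 b * countInjective N k Q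
countInjective-∧ N k b Q = trans
  (countWords-cong N k (λ w → trans (sym (∧-assoc (distinct (toList w)) b (Q (values w))))
                        (trans (cong (_∧ Q (values w)) (∧-comm (distinct (toList w)) b)) (∧-assoc b (distinct (toList w)) (Q (values w))))))
  (countWords-∧ N k b (λ w → distinct (toList w) ∧ Q (values w)))

punchInℕ : ℕ → ℕ → ℕ
punchInℕ i j = if j <ᵇ i then j else suc j


toℕ-punchIn : ∀ {N} (i : Fin (suc N)) (j : Fin N) → toℕ (punchIn i j) ≡ punchInℕ (toℕ i) (toℕ j)
toℕ-punchIn Fin.zero    j            = refl
toℕ-punchIn (Fin.suc i) Fin.zero     = refl
toℕ-punchIn (Fin.suc i) (Fin.suc j) with toℕ j <ᵇ toℕ i | toℕ-punchIn i j
... | true  | eq = cong suc eq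
... | false | eq = cong suc eq

values-punchIn : ∀ {N k} (a : Fin (suc N)) (v : Vec (Fin N) k) →
  values (Vec.map (punchIn a) v) ≡ List.map (punchInℕ (toℕ a)) (values v)
values-punchIn a []      = refl
values-punchIn a (c ∷ v) = cong₂ _∷_ (toℕ-punchIn a c) (values-punchIn a v)

countInjective-cons : ∀ N k (Q : List ℕ → Bool) →
  countInjective (suc N) (suc k) Q ≡ ℕΣ.∑[ x < suc N ] countInjective N k (λ ys → Q (x ∷ List.map (punchInℕ x) ys))
countInjective-cons N k Q = begin
  countInjective (suc N) (suc k) Q
    ≡⟨ countWords-cons (suc N) k (λ w → distinct (toList w) ∧ Q (values w)) ⟩
  Fin∑.sum {suc N} (λ a → countWords (suc N) k (λ w → (notIn a (toList w) ∧ distinct (toList w)) ∧ Q (toℕ a ∷ values w)))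
    ≡⟨ Fin∑.sum-cong-≗ {suc N} (λ a → countWords-cong (suc N) k (λ w → ∧-assoc (notIn a (toList w)) (distinct (toList w)) (Q (toℕ a ∷ values w)))) ⟩
  Fin∑.sum {suc N} (λ a → countWords (suc N) k (λ w → notIn a (toList w) ∧ (distinct (toList w) ∧ Q (toℕ a ∷ values w))))
    ≡⟨ Fin∑.sum-cong-≗ {suc N} (λ a → countWords-notIn N k a (λ w → distinct (toList w) ∧ Q (toℕ a ∷ values w))) ⟩
  Fin∑.sum {suc N} (λ a → countWords N k (λ v → distinct (toList (Vec.map (punchIn a) v)) ∧ Q (toℕ a ∷ values (Vec.map (punchIn a) v))))
    ≡⟨ Fin∑.sum-cong-≗ {suc N} (λ a → countWords-cong N k (λ v → cong₂ (λ d ys → d ∧ Q (toℕ a ∷ ys))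
         (trans (cong distinct (toList-map (punchIn a) v)) (distinct-map (punchIn a) (punchIn-injective a _ _) (toList v)))
         (values-punchIn a v))) ⟩
  Fin∑.sum {suc N} (λ a → countInjective N k (λ ys → Q (toℕ a ∷ List.map (punchInℕ (toℕ a)) ys)))
    ≡⟨ ℕΣ.∑≡sum (suc N) (λ x → countInjective N k (λ ys → Q (x ∷ List.map (punchInℕ x) ys))) ⟨
  ℕΣ.∑[ x < suc N ] countInjective N k (λ ys → Q (x ∷ List.map (punchInℕ x) ys))
    ∎
  where open ≡-Reasoning

complement : ℕ → ℕ → ℕ
complement N x = N ∸ suc x

opposite-injective : ∀ {N} → Injective _≡_ _≡_ (opposite {N})
opposite-injective {x = x} {y} eq = trans (sym (opposite-involutive x)) (trans (cong opposite eq) (opposite-involutive y))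

values-opposite : ∀ {N k} (w : Vec (Fin N) k) → values (Vec.map opposite w) ≡ List.map (complement N) (values w)
values-opposite []      = refl
values-opposite (a ∷ w) = cong₂ _∷_ (opposite-prop a) (values-opposite w)

countInjective-complement : ∀ N k (Q : List ℕ → Bool) →
  countInjective N k (Q ∘ List.map (complement N)) ≡ countInjective N k Q
countInjective-complement N k Q = trans
  (countWords-cong N k (λ w → cong₂ (λ d ys → d ∧ Q ys)
     (sym (trans (cong distinct (toList-map opposite w)) (distinct-map opposite opposite-injective (toList w))))
     (sym (values-opposite w))))
  (countWords-opposite N k (λ w → distinct (toList w) ∧ Q (values w)))

countInjective-reverse : ∀ N k (Q : List ℕ → Bool) →
  countInjective N k (Q ∘ List.reverse) ≡ countInjective N k Q
countInjective-reverse N k Q = trans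
  (countWords-cong N k (λ w → cong₂ (λ d ys → d ∧ Q ys)
     (sym (trans (cong distinct (toList-reverse w)) (distinct-reverse (toList w))))
     (sym (trans (cong (List.map toℕ) (toList-reverse w)) (reverse-map toℕ (toList w))))))
  (countWords-reverse N k (λ w → distinct (toList w) ∧ Q (values w)))

length-values : ∀ {N k} (w : Vec (Fin N) k) → List.length (values w) ≡ k
length-values []      = refl
length-values (a ∷ w) = cong suc (length-values w)

values-< : ∀ {N k} (w : Vec (Fin N) k) → All (_< N) (values w)
values-< []      = []
values-< (a ∷ w) = toℕ<n a ∷ values-< w

countInjective-first : ∀ N k (Q : List ℕ → Bool) (b : ℕ → Bool) (Q′ : ℕ → List ℕ → Bool) →
  (∀ x (w : Vec (Fin N) k) → Q (x ∷ List.map (punchInℕ x) (values w)) ≡ b x ∧ Q′ x (values w)) →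
  countInjective (suc N) (suc k) Q ≡ ℕΣ.∑[ x < suc N ] (𝟙 (b x) * countInjective N k (Q′ x))
countInjective-first N k Q b Q′ split = trans (countInjective-cons N k Q) (ℕΣ.∑-cong (suc N) (λ x _ →
  trans (countInjective-cong N k (λ ys → Q (x ∷ List.map (punchInℕ x) ys)) (λ ys → b x ∧ Q′ x ys) (split x)) (countInjective-∧ N k (b x) (Q′ x))))

-- Alternation and the pattern 3412

punchInℕ-<ᵇ : ∀ x y z → (punchInℕ x y <ᵇ punchInℕ x z) ≡ (y <ᵇ z)
punchInℕ-<ᵇ x y z with y <ᵇ x in y<x | z <ᵇ x in z<x
... | true  | true  = refl
... | true  | false = trans (<⇒<ᵇ≡true (m≤n⇒m≤1+n y<z)) (sym (<⇒<ᵇ≡true y<z))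
  where y<z = ≤-trans (<ᵇ≡true⇒< y x y<x) (<ᵇ≡false⇒≥ z x z<x)
... | false | true  = trans (≥⇒<ᵇ≡false (m≤n⇒m≤1+n (<⇒≤ z<y))) (sym (≥⇒<ᵇ≡false (<⇒≤ z<y)))
  where z<y = ≤-trans (<ᵇ≡true⇒< z x z<x) (<ᵇ≡false⇒≥ y x y<x)
... | false | false = refl

<ᵇ-punchInℕ : ∀ x y → (x <ᵇ punchInℕ x y) ≡ not (y <ᵇ x)
<ᵇ-punchInℕ x y with y <ᵇ x in y<x
... | true  = ≥⇒<ᵇ≡false (<⇒≤ (<ᵇ≡true⇒< y x y<x))
... | false = <⇒<ᵇ≡true (s≤s (<ᵇ≡false⇒≥ y x y<x))

punchInℕ-<ᵇ-self : ∀ x y → (punchInℕ x y <ᵇ x) ≡ (y <ᵇ x)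
punchInℕ-<ᵇ-self x y with y <ᵇ x in y<x
... | true  = y<x
... | false = ≥⇒<ᵇ≡false (m≤n⇒m≤1+n (<ᵇ≡false⇒≥ y x y<x))

-- The threshold u, read in the scale from which the value x has been removed.
punchOutℕ : ℕ → ℕ → ℕ
punchOutℕ x u = if x <ᵇ u then u ∸ 1 else u

punchInℕ-<ᵇ-punchOutℕ : ∀ x y u → (punchInℕ x y <ᵇ u) ≡ (y <ᵇ punchOutℕ x u)
punchInℕ-<ᵇ-punchOutℕ x y u with x <ᵇ u in x<u | y <ᵇ x in y<x
punchInℕ-<ᵇ-punchOutℕ x y (suc u) | true | true =
  trans (<⇒<ᵇ≡true (<-trans (<ᵇ≡true⇒< y x y<x) (<ᵇ≡true⇒< x (suc u) x<u)))
        (sym (<⇒<ᵇ≡true (≤-trans (<ᵇ≡true⇒< y x y<x) (≤-pred (<ᵇ≡true⇒< x (suc u) x<u)))))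
punchInℕ-<ᵇ-punchOutℕ x y (suc u) | true | false = refl
punchInℕ-<ᵇ-punchOutℕ x y u       | false | true = refl
punchInℕ-<ᵇ-punchOutℕ x y u       | false | false =
  trans (≥⇒<ᵇ≡false (m≤n⇒m≤1+n u≤y)) (sym (≥⇒<ᵇ≡false u≤y))
  where u≤y = ≤-trans (<ᵇ≡false⇒≥ x u x<u) (<ᵇ≡false⇒≥ y x y<x)

punchOutℕ-self : ∀ x → punchOutℕ x x ≡ x
punchOutℕ-self x rewrite ≥⇒<ᵇ≡false (ℕₚ.≤-refl {x}) = refl

altFrom-map : ∀ (f : ℕ → ℕ) → (∀ y z → (f y <ᵇ f z) ≡ (y <ᵇ z)) → ∀ d ys → altFrom d (List.map f ys) ≡ altFrom d ys
altFrom-map f f-mono d     []           = refl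
altFrom-map f f-mono d     (y ∷ [])     = refl
altFrom-map f f-mono true  (y ∷ z ∷ ys) = cong₂ _∧_ (f-mono y z) (altFrom-map f f-mono false (z ∷ ys))
altFrom-map f f-mono false (y ∷ z ∷ ys) = cong₂ _∧_ (f-mono z y) (altFrom-map f f-mono true (z ∷ ys))

-- altAfter d t xs: xs continues, in direction d, an alternating sequence whose previous entry is
-- the virtual value t - 1/2.
stepAfter : Bool → ℕ → ℕ → Bool
stepAfter true  t x = not (x <ᵇ t)
stepAfter false t x = x <ᵇ t

altAfter : Bool → ℕ → List ℕ → Bool
altAfter d t []       = true
altAfter d t (y ∷ ys) = stepAfter d t y ∧ altFrom (not d) (y ∷ ys)

altFrom-punchInℕ : ∀ d x ys → altFrom d (x ∷ List.map (punchInℕ x) ys) ≡ altAfter d x ys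
altFrom-punchInℕ d     x []       = refl
altFrom-punchInℕ true  x (y ∷ ys) = cong₂ _∧_ (<ᵇ-punchInℕ x y) (altFrom-map (punchInℕ x) (punchInℕ-<ᵇ x) false (y ∷ ys))
altFrom-punchInℕ false x (y ∷ ys) = cong₂ _∧_ (punchInℕ-<ᵇ-self x y) (altFrom-map (punchInℕ x) (punchInℕ-<ᵇ x) true (y ∷ ys))

altAfter-punchInℕ : ∀ d t x ys → altAfter d t (x ∷ List.map (punchInℕ x) ys) ≡ stepAfter d t x ∧ altAfter (not d) x ys
altAfter-punchInℕ d t x ys = cong (stepAfter d t x ∧_) (altFrom-punchInℕ (not d) x ys)

lessAt : ℕ → ℕ → List ℕ → Bool
lessAt i       u []       = false
lessAt zero    u (y ∷ ys) = y <ᵇ u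
lessAt (suc i) u (y ∷ ys) = lessAt i u ys

lessAt-punchInℕ : ∀ i u x ys → lessAt i u (List.map (punchInℕ x) ys) ≡ lessAt i (punchOutℕ x u) ys
lessAt-punchInℕ i       u x []       = refl
lessAt-punchInℕ zero    u x (y ∷ ys) = punchInℕ-<ᵇ-punchOutℕ x y u
lessAt-punchInℕ (suc i) u x (y ∷ ys) = lessAt-punchInℕ i u x ys

fourth<first : List ℕ → Bool
fourth<first []       = false
fourth<first (x ∷ ys) = lessAt 2 x ys

fourth<first-punchInℕ : ∀ x ys → fourth<first (x ∷ List.map (punchInℕ x) ys) ≡ lessAt 2 x ys
fourth<first-punchInℕ x ys = trans (lessAt-punchInℕ 2 x x ys) (cong (λ u → lessAt 2 u ys) (punchOutℕ-self x))

last<fourthLast : List ℕ → Bool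
last<fourthLast (a ∷ b ∷ c ∷ d ∷ [])       = d <ᵇ a
last<fourthLast (x ∷ y ∷ z ∷ w ∷ v ∷ vs)   = last<fourthLast (y ∷ z ∷ w ∷ v ∷ vs)
last<fourthLast _                          = false

last<fourthLast-punchInℕ : ∀ x ys → last<fourthLast (List.map (punchInℕ x) ys) ≡ last<fourthLast ys
last<fourthLast-punchInℕ x []                        = refl
last<fourthLast-punchInℕ x (a ∷ [])                  = refl
last<fourthLast-punchInℕ x (a ∷ b ∷ [])              = refl
last<fourthLast-punchInℕ x (a ∷ b ∷ c ∷ [])          = refl
last<fourthLast-punchInℕ x (a ∷ b ∷ c ∷ d ∷ [])      = punchInℕ-<ᵇ x d a
last<fourthLast-punchInℕ x (a ∷ b ∷ c ∷ d ∷ v ∷ vs)  = last<fourthLast-punchInℕ x (b ∷ c ∷ d ∷ v ∷ vs)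

last<fourthLast-∷ : ∀ x ys → 4 ≤ length ys → last<fourthLast (x ∷ ys) ≡ last<fourthLast ys
last<fourthLast-∷ x (a ∷ b ∷ c ∷ d ∷ vs) _ = refl
last<fourthLast-∷ x (a ∷ []) (s≤s ())
last<fourthLast-∷ x (a ∷ b ∷ []) (s≤s (s≤s ()))
last<fourthLast-∷ x (a ∷ b ∷ c ∷ []) (s≤s (s≤s (s≤s ())))

orderIso-3412 : ∀ a b c d → (a <ᵇ b) ≡ true → (c <ᵇ b) ≡ true → (c <ᵇ d) ≡ true →
  orderIso (a ∷ b ∷ c ∷ d ∷ []) p3412 ≡ (d <ᵇ a)
orderIso-3412 a b c d a<ᵇb c<ᵇb c<ᵇd = by-cases (d <ᵇ a) refl
  where
  a<b = <ᵇ≡true⇒< a b a<ᵇb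
  c<b = <ᵇ≡true⇒< c b c<ᵇb
  c<d = <ᵇ≡true⇒< c d c<ᵇd

  matches : d < a → orderIso (a ∷ b ∷ c ∷ d ∷ []) p3412 ≡ true
  matches d<a
    rewrite <⇒<ᵇ≡true a<b | <⇒<ᵇ≡true c<b | <⇒<ᵇ≡true c<d | <⇒<ᵇ≡true d<a
          | ≥⇒<ᵇ≡false (<⇒≤ a<b) | ≥⇒<ᵇ≡false (<⇒≤ c<b) | ≥⇒<ᵇ≡false (<⇒≤ c<d) | ≥⇒<ᵇ≡false (<⇒≤ d<a)
          | <⇒<ᵇ≡true (<-trans c<d d<a) | ≥⇒<ᵇ≡false (<⇒≤ (<-trans c<d d<a))
          | <⇒<ᵇ≡true (<-trans d<a a<b) | ≥⇒<ᵇ≡false (<⇒≤ (<-trans d<a a<b)) = refl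

  absorb : ∀ x y w → (x ∧ ((y ∧ false) ∧ true)) ∧ w ≡ false
  absorb false y     w = refl
  absorb true  false w = refl
  absorb true  true  w = refl

  mismatch : (d <ᵇ a) ≡ false → orderIso (a ∷ b ∷ c ∷ d ∷ []) p3412 ≡ false
  mismatch d≮a rewrite a<ᵇb | d≮a | ≥⇒<ᵇ≡false (<⇒≤ a<b) =
    absorb (((a <ᵇ c) ==ᵇ false) ∧ ((c <ᵇ a) ==ᵇ true)) ((a <ᵇ d) ==ᵇ false) _

  by-cases : ∀ x → (d <ᵇ a) ≡ x → orderIso (a ∷ b ∷ c ∷ d ∷ []) p3412 ≡ (d <ᵇ a)
  by-cases true  d<ᵇa = trans (matches (<ᵇ≡true⇒< d a d<ᵇa)) (sym d<ᵇa)
  by-cases false d≮ᵇa = trans (mismatch d≮ᵇa) (sym d≮ᵇa)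

orderIso-take-3412 : ∀ xs → 4 ≤ length xs →
  altFrom true xs ∧ orderIso (take 4 xs) p3412 ≡ altFrom true xs ∧ fourth<first xs
orderIso-take-3412 (a ∷ b ∷ c ∷ d ∷ rest) _ = by-cases (a <ᵇ b) refl (c <ᵇ b) refl (c <ᵇ d) refl
  where
  xs = a ∷ b ∷ c ∷ d ∷ rest
  by-cases : ∀ x → (a <ᵇ b) ≡ x → ∀ y → (c <ᵇ b) ≡ y → ∀ z → (c <ᵇ d) ≡ z →
    altFrom true xs ∧ orderIso (take 4 xs) p3412 ≡ altFrom true xs ∧ fourth<first xs
  by-cases true  a<b true  c<b true  c<d = cong (altFrom true xs ∧_) (orderIso-3412 a b c d a<b c<b c<d)
  by-cases true  a<b true  c<b false c≮d rewrite a<b | c<b | c≮d = refl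
  by-cases true  a<b false c≮b _     _   rewrite a<b | c≮b = refl
  by-cases false a≮b _     _   _     _   rewrite a≮b = refl
orderIso-take-3412 (a ∷ [])         (s≤s ())
orderIso-take-3412 (a ∷ b ∷ [])     (s≤s (s≤s ()))
orderIso-take-3412 (a ∷ b ∷ c ∷ []) (s≤s (s≤s (s≤s ())))

stepIn : Bool → ℕ → ℕ → Bool
stepIn true  x y = x <ᵇ y
stepIn false x y = y <ᵇ x

altFrom-∷ : ∀ d x y ys → altFrom d (x ∷ y ∷ ys) ≡ stepIn d x y ∧ altFrom (not d) (y ∷ ys)
altFrom-∷ true  x y ys = refl
altFrom-∷ false x y ys = refl

altFrom-not-∷ : ∀ d x y ys → altFrom (not d) (x ∷ y ∷ ys) ≡ stepIn (not d) x y ∧ altFrom d (y ∷ ys)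
altFrom-not-∷ d x y ys = trans (altFrom-∷ (not d) x y ys) (cong (λ e → stepIn (not d) x y ∧ altFrom e (y ∷ ys)) (not-involutive d))

∧-cong-under : ∀ a {b x y} → b ∧ x ≡ b ∧ y → (a ∧ b) ∧ x ≡ (a ∧ b) ∧ y
∧-cong-under a {b} {x} {y} eq = trans (∧-assoc a b x) (trans (cong (a ∧_) eq) (sym (∧-assoc a b y)))

orderIso-drop-3412 : ∀ xs → 4 ≤ length xs →
  altFrom (isEven (length xs)) xs ∧ orderIso (drop (length xs ∸ 4) xs) p3412
    ≡ altFrom (isEven (length xs)) xs ∧ last<fourthLast xs
orderIso-drop-3412 xs@(a ∷ b ∷ c ∷ d ∷ []) 4≤ = orderIso-take-3412 xs 4≤
orderIso-drop-3412 (x ∷ ys@(a ∷ b ∷ c ∷ d ∷ vs)) _ = begin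
  altFrom (not e) (x ∷ ys) ∧ orderIso (drop (length vs) ys) p3412
    ≡⟨ cong (_∧ _) (altFrom-not-∷ e x a (b ∷ c ∷ d ∷ vs)) ⟩
  (stepIn (not e) x a ∧ altFrom e ys) ∧ orderIso (drop (length vs) ys) p3412
    ≡⟨ ∧-cong-under (stepIn (not e) x a) (orderIso-drop-3412 ys (s≤s (s≤s (s≤s (s≤s z≤n))))) ⟩
  (stepIn (not e) x a ∧ altFrom e ys) ∧ last<fourthLast ys
    ≡⟨ cong (_∧ _) (altFrom-not-∷ e x a (b ∷ c ∷ d ∷ vs)) ⟨
  altFrom (not e) (x ∷ ys) ∧ last<fourthLast ys
    ∎
  where
  open ≡-Reasoning
  e = isEven (length ys)
orderIso-drop-3412 (a ∷ [])         (s≤s ())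
orderIso-drop-3412 (a ∷ b ∷ [])     (s≤s (s≤s ()))
orderIso-drop-3412 (a ∷ b ∷ c ∷ []) (s≤s (s≤s (s≤s ())))

lastStepIn : Bool → List ℕ → ℕ → Bool
lastStepIn d []           y = true
lastStepIn d (z ∷ [])     y = stepIn d z y
lastStepIn d (z ∷ w ∷ ws) y = lastStepIn (not d) (w ∷ ws) y

altFrom-snoc : ∀ d zs y → altFrom d (zs ++ [ y ]) ≡ altFrom d zs ∧ lastStepIn d zs y
altFrom-snoc d []           y = refl
altFrom-snoc d (z ∷ [])     y = trans (altFrom-∷ d z y []) (∧-identityʳ (stepIn d z y))
altFrom-snoc d (z ∷ w ∷ ws) y = begin
  altFrom d (z ∷ w ∷ ws ++ [ y ])                                    ≡⟨ altFrom-∷ d z w (ws ++ [ y ]) ⟩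
  stepIn d z w ∧ altFrom (not d) (w ∷ ws ++ [ y ])                   ≡⟨ cong (stepIn d z w ∧_) (altFrom-snoc (not d) (w ∷ ws) y) ⟩
  stepIn d z w ∧ (altFrom (not d) (w ∷ ws) ∧ lastStepIn (not d) (w ∷ ws) y) ≡⟨ ∧-assoc (stepIn d z w) _ _ ⟨
  (stepIn d z w ∧ altFrom (not d) (w ∷ ws)) ∧ lastStepIn (not d) (w ∷ ws) y ≡⟨ cong (_∧ _) (altFrom-∷ d z w ws) ⟨
  altFrom d (z ∷ w ∷ ws) ∧ lastStepIn d (z ∷ w ∷ ws) y               ∎
  where open ≡-Reasoning

lastStepIn-snoc : ∀ d ws y x → lastStepIn d (ws ++ [ y ]) x ≡ stepIn (iterate not d (length ws)) y x
lastStepIn-snoc d []           y x = refl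
lastStepIn-snoc d (w ∷ [])     y x = refl
lastStepIn-snoc d (w ∷ w′ ∷ ws) y x = lastStepIn-snoc (not d) (w′ ∷ ws) y x

iterate-not-not : ∀ d n → iterate not (not d) n ≡ not (iterate not d n)
iterate-not-not d zero    = refl
iterate-not-not d (suc n) = iterate-not-not (not d) n

iterate-not-true : ∀ n → iterate not true n ≡ isEven n
iterate-not-true zero    = refl
iterate-not-true (suc n) = trans (iterate-not-not true n) (cong not (iterate-not-true n))

stepIn-not : ∀ d x y → stepIn (not d) x y ≡ stepIn d y x
stepIn-not true  x y = refl
stepIn-not false x y = refl

altFrom-reverse : ∀ d x xs → altFrom d (List.reverse (x ∷ xs)) ≡ altFrom (iterate not d (length xs)) (x ∷ xs)
altFrom-reverse d x []       = refl
altFrom-reverse d x (y ∷ ys) = begin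
  altFrom d (List.reverse (x ∷ y ∷ ys))                                   ≡⟨ cong (altFrom d) (unfold-reverse x (y ∷ ys)) ⟩
  altFrom d (List.reverse (y ∷ ys) ++ [ x ])                              ≡⟨ altFrom-snoc d (List.reverse (y ∷ ys)) x ⟩
  altFrom d (List.reverse (y ∷ ys)) ∧ lastStepIn d (List.reverse (y ∷ ys)) x ≡⟨ cong₂ _∧_ (altFrom-reverse d y ys) lastStep ⟩
  altFrom e (y ∷ ys) ∧ stepIn e y x                                       ≡⟨ ∧-comm (altFrom e (y ∷ ys)) (stepIn e y x) ⟩
  stepIn e y x ∧ altFrom e (y ∷ ys)                                       ≡⟨ cong (_∧ altFrom e (y ∷ ys)) (stepIn-not e x y) ⟨
  stepIn (not e) x y ∧ altFrom e (y ∷ ys)                                 ≡⟨ altFrom-not-∷ e x y ys ⟨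
  altFrom (not e) (x ∷ y ∷ ys)                                            ≡⟨ cong (λ d′ → altFrom d′ (x ∷ y ∷ ys)) (iterate-not-not d (length ys)) ⟨
  altFrom (iterate not d (length (y ∷ ys))) (x ∷ y ∷ ys)                  ∎
  where
  open ≡-Reasoning
  e = iterate not d (length ys)
  lastStep : lastStepIn d (List.reverse (y ∷ ys)) x ≡ stepIn e y x
  lastStep = begin
    lastStepIn d (List.reverse (y ∷ ys)) x                      ≡⟨ cong (λ zs → lastStepIn d zs x) (unfold-reverse y ys) ⟩
    lastStepIn d (List.reverse ys ++ [ y ]) x                   ≡⟨ lastStepIn-snoc d (List.reverse ys) y x ⟩
    stepIn (iterate not d (length (List.reverse ys))) y x       ≡⟨ cong (λ n → stepIn (iterate not d n) y x) (length-reverse ys) ⟩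
    stepIn e y x                                                ∎

complement-<ᵇ : ∀ N x y → x < N → y < N → (complement N x <ᵇ complement N y) ≡ (y <ᵇ x)
complement-<ᵇ (suc N) zero    zero    _         _         = ≥⇒<ᵇ≡false (ℕₚ.≤-refl {N})
complement-<ᵇ (suc N) zero    (suc y) _         _         = ≥⇒<ᵇ≡false (m∸n≤m N (suc y))
complement-<ᵇ (suc N) (suc x) zero    (s≤s x<N) _         = <⇒<ᵇ≡true (∸-suc-< x<N)
  where
  ∸-suc-< : ∀ {x N} → x < N → N ∸ suc x < N
  ∸-suc-< {x} {suc N} _ = s≤s (m∸n≤m N x)
complement-<ᵇ (suc N) (suc x) (suc y) (s≤s x<N) (s≤s y<N) = complement-<ᵇ N x y x<N y<N

altFrom-complement : ∀ N d {xs} → All (_< N) xs → altFrom d (List.map (complement N) xs) ≡ altFrom (not d) xs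
altFrom-complement N d     []                 = refl
altFrom-complement N d     (_ ∷ [])           = refl
altFrom-complement N true  {x ∷ y ∷ _} (x<N ∷ y<N ∷ bs) =
  cong₂ _∧_ (complement-<ᵇ N x y x<N y<N) (altFrom-complement N false (y<N ∷ bs))
altFrom-complement N false {x ∷ y ∷ _} (x<N ∷ y<N ∷ bs) =
  cong₂ _∧_ (complement-<ᵇ N y x y<N x<N) (altFrom-complement N true (y<N ∷ bs))

reverseComplement : ℕ → List ℕ → List ℕ
reverseComplement N xs = List.reverse (List.map (complement N) xs)

altFrom-reverseComplement : ∀ N {xs} → All (_< N) xs →
  altFrom true (reverseComplement N xs) ≡ altFrom (isEven (length xs)) xs
altFrom-reverseComplement N []                   = refl
altFrom-reverseComplement N {x ∷ xs} bs@(_ ∷ _) = begin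
  altFrom true (List.reverse (cx ∷ cxs))
    ≡⟨ altFrom-reverse true cx cxs ⟩
  altFrom (iterate not true (length cxs)) (cx ∷ cxs)
    ≡⟨ cong (λ n → altFrom (iterate not true n) (cx ∷ cxs)) (length-map (complement N) xs) ⟩
  altFrom (iterate not true (length xs)) (cx ∷ cxs)
    ≡⟨ altFrom-complement N _ bs ⟩
  altFrom (not (iterate not true (length xs))) (x ∷ xs)
    ≡⟨ cong (λ e → altFrom (not e) (x ∷ xs)) (iterate-not-true (length xs)) ⟩
  altFrom (isEven (length (x ∷ xs))) (x ∷ xs)
    ∎
  where
  open ≡-Reasoning
  cx = complement N x
  cxs = List.map (complement N) xs

fourth<first-++ : ∀ ys zs → 4 ≤ length ys → fourth<first (ys ++ zs) ≡ fourth<first ys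
fourth<first-++ (a ∷ b ∷ c ∷ d ∷ _) zs _ = refl
fourth<first-++ (a ∷ [])         zs (s≤s ())
fourth<first-++ (a ∷ b ∷ [])     zs (s≤s (s≤s ()))
fourth<first-++ (a ∷ b ∷ c ∷ []) zs (s≤s (s≤s (s≤s ())))

fourth<first-reverseComplement : ∀ N {xs} → 4 ≤ length xs → All (_< N) xs →
  fourth<first (reverseComplement N xs) ≡ last<fourthLast xs
fourth<first-reverseComplement N {a ∷ b ∷ c ∷ d ∷ []} _ (a<N ∷ _ ∷ _ ∷ d<N ∷ []) = complement-<ᵇ N a d a<N d<N
fourth<first-reverseComplement N {x ∷ ys@(a ∷ b ∷ c ∷ d ∷ vs)} _ (_ ∷ bs) = begin
  fourth<first (reverseComplement N (x ∷ ys))                         ≡⟨ cong fourth<first (unfold-reverse (complement N x) (List.map (complement N) ys)) ⟩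
  fourth<first (reverseComplement N ys ++ [ complement N x ])         ≡⟨ fourth<first-++ (reverseComplement N ys) _ 4≤rc ⟩
  fourth<first (reverseComplement N ys)                               ≡⟨ fourth<first-reverseComplement N 4≤ bs ⟩
  last<fourthLast ys                                                  ∎
  where
  open ≡-Reasoning
  4≤ : 4 ≤ length ys
  4≤ = s≤s (s≤s (s≤s (s≤s z≤n)))
  4≤rc : 4 ≤ length (reverseComplement N ys)
  4≤rc = subst (4 ≤_) (sym (trans (length-reverse (List.map (complement N) ys)) (length-map (complement N) ys))) 4≤
fourth<first-reverseComplement N {a ∷ []}         (s≤s ())                   _
fourth<first-reverseComplement N {a ∷ b ∷ []}     (s≤s (s≤s ()))             _
fourth<first-reverseComplement N {a ∷ b ∷ c ∷ []} (s≤s (s≤s (s≤s ())))       _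

-- Alternating permutations, entry by entry

-- Conditions on the end of a permutation that survive deleting its first entry and standardising.
record SuffixProperty : Set where
  field
    holds          : List ℕ → Bool
    span           : ℕ
    holds-punchInℕ : ∀ x ys → holds (List.map (punchInℕ x) ys) ≡ holds ys
    holds-∷        : ∀ x ys → span ≤ length ys → holds (x ∷ ys) ≡ holds ys

suffix3412 : SuffixProperty
suffix3412 = record
  { holds = last<fourthLast ; span = 4 ; holds-punchInℕ = last<fourthLast-punchInℕ ; holds-∷ = last<fourthLast-∷ }

anySuffix : SuffixProperty
anySuffix = record { holds = λ _ → true ; span = 0 ; holds-punchInℕ = λ _ _ → refl ; holds-∷ = λ _ _ _ → refl }

module Counts (R : SuffixProperty) where

  open SuffixProperty R

  alternating : ℕ → Bool → ℕ
  alternating n d = countInjective n n (λ xs → altFrom d xs ∧ holds xs)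

  prefixed : ℕ → ℕ
  prefixed n = countInjective n n (λ xs → altFrom true xs ∧ (fourth<first xs ∧ holds xs))

  completions : ℕ → Bool → ℕ → ℕ
  completions N d t = countInjective N N (λ xs → altAfter d t xs ∧ holds xs)

  completionsLess : ℕ → Bool → ℕ → ℕ → ℕ → ℕ
  completionsLess N d t i u = countInjective N N (λ xs → altAfter d t xs ∧ (lessAt i u xs ∧ holds xs))

  holds-first : ∀ {N} x (w : Vec (Fin N) N) → span ≤ N → holds (x ∷ List.map (punchInℕ x) (values w)) ≡ holds (values w)
  holds-first {N} x w span≤N = trans (holds-∷ x _ span≤length) (holds-punchInℕ x (values w))
    where
    span≤length : span ≤ length (List.map (punchInℕ x) (values w))
    span≤length = subst (span ≤_) (sym (trans (length-map (punchInℕ x) (values w)) (length-values w))) span≤N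

  alternating-suc : ∀ N d → span ≤ N → alternating (suc N) d ≡ ℕΣ.∑[ x < suc N ] completions N d x
  alternating-suc N d span≤N = trans (countInjective-cons N N (λ xs → altFrom d xs ∧ holds xs)) (ℕΣ.∑-cong (suc N) (λ x _ →
    countInjective-cong N N (λ ys → altFrom d (x ∷ List.map (punchInℕ x) ys) ∧ holds (x ∷ List.map (punchInℕ x) ys))
      (λ ys → altAfter d x ys ∧ holds ys)
      (λ w → cong₂ _∧_ (altFrom-punchInℕ d x (values w)) (holds-first x w span≤N))))

  prefixed-suc : ∀ N → span ≤ N → prefixed (suc N) ≡ ℕΣ.∑[ x < suc N ] completionsLess N true x 2 x
  prefixed-suc N span≤N = trans (countInjective-cons N N (λ xs → altFrom true xs ∧ (fourth<first xs ∧ holds xs))) (ℕΣ.∑-cong (suc N) (λ x _ →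
    countInjective-cong N N
      (λ ys → altFrom true (x ∷ List.map (punchInℕ x) ys) ∧ (fourth<first (x ∷ List.map (punchInℕ x) ys) ∧ holds (x ∷ List.map (punchInℕ x) ys)))
      (λ ys → altAfter true x ys ∧ (lessAt 2 x ys ∧ holds ys))
      (λ w → cong₂ _∧_ (altFrom-punchInℕ true x (values w))
      (cong₂ _∧_ (fourth<first-punchInℕ x (values w)) (holds-first x w span≤N)))))

  completions-suc : ∀ N d t → span ≤ N →
    completions (suc N) d t ≡ ℕΣ.∑[ x < suc N ] (𝟙 (stepAfter d t x) * completions N (not d) x)
  completions-suc N d t span≤N = countInjective-first N N
    (λ xs → altAfter d t xs ∧ holds xs) (stepAfter d t) (λ x ys → altAfter (not d) x ys ∧ holds ys) (λ x w →
    trans (cong₂ _∧_ (altAfter-punchInℕ d t x (values w)) (holds-first x w span≤N))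
          (∧-assoc (stepAfter d t x) _ _))

  completionsLess-suc : ∀ N d t i u → span ≤ N →
    completionsLess (suc N) d t (suc i) u
      ≡ ℕΣ.∑[ x < suc N ] (𝟙 (stepAfter d t x) * completionsLess N (not d) x i (punchOutℕ x u))
  completionsLess-suc N d t i u span≤N = countInjective-first N N
    (λ xs → altAfter d t xs ∧ (lessAt (suc i) u xs ∧ holds xs)) (stepAfter d t)
    (λ x ys → altAfter (not d) x ys ∧ (lessAt i (punchOutℕ x u) ys ∧ holds ys)) (λ x w →
    trans (cong₂ _∧_ (altAfter-punchInℕ d t x (values w))
                     (cong₂ _∧_ (lessAt-punchInℕ i u x (values w)) (holds-first x w span≤N)))
          (∧-assoc (stepAfter d t x) _ _))

  completionsLess-zero : ∀ N d t u → span ≤ N →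
    completionsLess (suc N) d t 0 u ≡ ℕΣ.∑[ x < suc N ] (𝟙 (stepAfter d t x ∧ (x <ᵇ u)) * completions N (not d) x)
  completionsLess-zero N d t u span≤N = countInjective-first N N
    (λ xs → altAfter d t xs ∧ (lessAt 0 u xs ∧ holds xs)) (λ x → stepAfter d t x ∧ (x <ᵇ u))
    (λ x ys → altAfter (not d) x ys ∧ holds ys) (λ x w →
    trans (cong₂ _∧_ (altAfter-punchInℕ d t x (values w)) (cong ((x <ᵇ u) ∧_) (holds-first x w span≤N)))
          (interchange (stepAfter d t x) _ (x <ᵇ u) _))
    where
    interchange : ∀ a b c d → (a ∧ b) ∧ (c ∧ d) ≡ (a ∧ c) ∧ (b ∧ d)
    interchange true  b true  d = refl
    interchange true  b false d = ∧-zeroʳ b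
    interchange false b c     d = refl

<ᵇ-⊓ : ∀ c b e → (c <ᵇ b ⊓ e) ≡ (c <ᵇ b) ∧ (c <ᵇ e)
<ᵇ-⊓ zero    zero    e       = refl
<ᵇ-⊓ zero    (suc b) zero    = refl
<ᵇ-⊓ zero    (suc b) (suc e) = refl
<ᵇ-⊓ (suc c) zero    e       = refl
<ᵇ-⊓ (suc c) (suc b) zero    = sym (∧-zeroʳ (c <ᵇ b))
<ᵇ-⊓ (suc c) (suc b) (suc e) = <ᵇ-⊓ c b e

not-<ᵇ : ∀ b a → not (b <ᵇ a) ≡ (a <ᵇ suc b)
not-<ᵇ b       zero    = refl
not-<ᵇ zero    (suc a) = refl
not-<ᵇ (suc b) (suc a) = not-<ᵇ b a

∑-below-and-atMost : ∀ K b d → b ≤ K → ℕΣ.∑[ c < K ] (𝟙 (c <ᵇ b) * 𝟙 (not (d <ᵇ c))) ≡ b ⊓ suc d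
∑-below-and-atMost K b d b≤K = begin
  ℕΣ.∑[ c < K ] (𝟙 (c <ᵇ b) * 𝟙 (not (d <ᵇ c)))  ≡⟨ ℕΣ.∑-cong K (λ c _ → trans (sym (𝟙-∧ (c <ᵇ b) _))
                                                     (cong 𝟙 (trans (cong ((c <ᵇ b) ∧_) (not-<ᵇ d c)) (sym (<ᵇ-⊓ c b (suc d)))))) ⟩
  ℕΣ.∑[ c < K ] 𝟙 (c <ᵇ b ⊓ suc d)               ≡⟨ ∑𝟙<ᵇ K (b ⊓ suc d) ⟩
  K ⊓ (b ⊓ suc d)                                ≡⟨ m≥n⇒m⊓n≡n (≤-trans (ℕₚ.m⊓n≤m b (suc d)) b≤K) ⟩
  b ⊓ suc d                                      ∎
  where open ≡-Reasoning

∑-atLeast : ∀ K b → b < K → ℕΣ.∑[ a < K ] 𝟙 (not (b <ᵇ a)) ≡ suc b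
∑-atLeast K b b<K = trans (ℕΣ.∑-cong K (λ a _ → cong 𝟙 (not-<ᵇ b a)))
                          (trans (∑𝟙<ᵇ K (suc b)) (m≥n⇒m⊓n≡n b<K))

∑-between : ∀ K s r → s ≤ K → ℕΣ.∑[ a < K ] (𝟙 (a <ᵇ s) * 𝟙 (r <ᵇ a)) ≡ s ∸ suc r
∑-between K s r s≤K = ℕₚ.+-cancelʳ-≡ (s ⊓ suc r) _ _ (begin
  ℕΣ.∑[ a < K ] (𝟙 (a <ᵇ s) * 𝟙 (r <ᵇ a)) + s ⊓ suc r
    ≡⟨ cong (_+_ (ℕΣ.∑[ a < K ] (𝟙 (a <ᵇ s) * 𝟙 (r <ᵇ a)))) (∑-below-and-atMost K s r s≤K) ⟨
  ℕΣ.∑[ a < K ] (𝟙 (a <ᵇ s) * 𝟙 (r <ᵇ a)) + ℕΣ.∑[ a < K ] (𝟙 (a <ᵇ s) * 𝟙 (not (r <ᵇ a)))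
    ≡⟨ ℕΣ.∑-distrib-+ K (λ a → 𝟙 (a <ᵇ s) * 𝟙 (r <ᵇ a)) (λ a → 𝟙 (a <ᵇ s) * 𝟙 (not (r <ᵇ a))) ⟨
  ℕΣ.∑[ a < K ] (𝟙 (a <ᵇ s) * 𝟙 (r <ᵇ a) + 𝟙 (a <ᵇ s) * 𝟙 (not (r <ᵇ a)))
    ≡⟨ ℕΣ.∑-cong K (λ a _ → split (a <ᵇ s) (r <ᵇ a)) ⟩
  ℕΣ.∑[ a < K ] 𝟙 (a <ᵇ s)
    ≡⟨ trans (∑𝟙<ᵇ K s) (m≥n⇒m⊓n≡n s≤K) ⟩
  s
    ≡⟨ ℕₚ.m⊓n+n∸m≡n (suc r) s ⟨
  suc r ⊓ s + (s ∸ suc r)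
    ≡⟨ trans (ℕₚ.+-comm (suc r ⊓ s) _) (cong (_+_ (s ∸ suc r)) (ℕₚ.⊓-comm (suc r) s)) ⟩
  s ∸ suc r + s ⊓ suc r
    ∎)
  where
  open ≡-Reasoning
  split : ∀ x y → 𝟙 x * 𝟙 y + 𝟙 x * 𝟙 (not y) ≡ 𝟙 x
  split true  true  = refl
  split true  false = refl
  split false y     = refl

twice-∑⊓ : ∀ M s → 2 * ℕΣ.∑[ b < M ] (b ⊓ s) + 2 * (M ⊓ s) ≡ (M ⊓ s) * (M ∸ s) + suc M * (M ⊓ s)
twice-∑⊓ zero    s = refl
twice-∑⊓ (suc M) s = begin
  2 * ℕΣ.∑[ b < suc M ] (b ⊓ s) + 2 * (suc M ⊓ s)          ≡⟨ cong (λ x → 2 * x + 2 * (suc M ⊓ s)) (ℕΣ.∑-snoc M (_⊓ s)) ⟩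
  2 * (ℕΣ.∑[ b < M ] (b ⊓ s) + M ⊓ s) + 2 * (suc M ⊓ s)    ≡⟨ cong (_+ 2 * (suc M ⊓ s)) (ℕₚ.*-distribˡ-+ 2 (ℕΣ.∑[ b < M ] (b ⊓ s)) (M ⊓ s)) ⟩
  2 * ℕΣ.∑[ b < M ] (b ⊓ s) + 2 * (M ⊓ s) + 2 * (suc M ⊓ s) ≡⟨ cong (_+ 2 * (suc M ⊓ s)) (twice-∑⊓ M s) ⟩
  (M ⊓ s) * (M ∸ s) + suc M * (M ⊓ s) + 2 * (suc M ⊓ s)    ≡⟨ step (ℕₚ.≤-<-connex s M) ⟩
  (suc M ⊓ s) * (suc M ∸ s) + suc (suc M) * (suc M ⊓ s)    ∎
  where
  open ≡-Reasoning
  saturated : ∀ M s k → s * k + suc M * s + 2 * s ≡ s * suc k + suc (suc M) * s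
  saturated = ℕ-Ring.solve-∀
  growing : ∀ M → M * 0 + suc M * M + 2 * suc M ≡ suc M * 0 + suc (suc M) * suc M
  growing = ℕ-Ring.solve-∀
  step : s ≤ M ⊎ M < s →
    (M ⊓ s) * (M ∸ s) + suc M * (M ⊓ s) + 2 * (suc M ⊓ s) ≡ (suc M ⊓ s) * (suc M ∸ s) + suc (suc M) * (suc M ⊓ s)
  step (inj₁ s≤M) rewrite m≥n⇒m⊓n≡n s≤M | m≥n⇒m⊓n≡n (m≤n⇒m≤1+n s≤M) | ℕₚ.+-∸-assoc 1 s≤M = saturated M s (M ∸ s)
  step (inj₂ M<s) rewrite m≤n⇒m⊓n≡m (<⇒≤ M<s) | m≤n⇒m⊓n≡m M<s | ℕₚ.m≤n⇒m∸n≡0 (<⇒≤ M<s) | ℕₚ.m≤n⇒m∸n≡0 M<s = growing M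

∑-weights : ∀ M s → ℕΣ.∑[ b < M ] ((b ⊓ s) * (b ∸ s) + 3 * (suc b * (b ⊓ s))) ≡ 2 * suc M * ℕΣ.∑[ b < M ] (b ⊓ s)
∑-weights zero    s = refl
∑-weights (suc M) s = begin
  ℕΣ.∑[ b < suc M ] ((b ⊓ s) * (b ∸ s) + 3 * (suc b * (b ⊓ s)))       ≡⟨ ℕΣ.∑-snoc M (λ b → (b ⊓ s) * (b ∸ s) + 3 * (suc b * (b ⊓ s))) ⟩
  ℕΣ.∑[ b < M ] ((b ⊓ s) * (b ∸ s) + 3 * (suc b * (b ⊓ s))) + ((M ⊓ s) * (M ∸ s) + 3 * (suc M * (M ⊓ s)))
                                                                      ≡⟨ cong (_+ ((M ⊓ s) * (M ∸ s) + 3 * (suc M * (M ⊓ s)))) (∑-weights M s) ⟩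
  2 * suc M * S + (f * k + 3 * (suc M * f))                           ≡⟨ regroup M S f k ⟩
  2 * suc M * S + (f * k + suc M * f) + 2 * suc M * f                 ≡⟨ cong (λ x → 2 * suc M * S + x + 2 * suc M * f) (twice-∑⊓ M s) ⟨
  2 * suc M * S + (2 * S + 2 * f) + 2 * suc M * f                     ≡⟨ collect M S f ⟩
  2 * suc (suc M) * (S + f)                                           ≡⟨ cong (2 * suc (suc M) *_) (ℕΣ.∑-snoc M (_⊓ s)) ⟨
  2 * suc (suc M) * ℕΣ.∑[ b < suc M ] (b ⊓ s)                         ∎
  where
  open ≡-Reasoning
  S = ℕΣ.∑[ b < M ] (b ⊓ s)
  f = M ⊓ s
  k = M ∸ s
  regroup : ∀ M S f k → 2 * suc M * S + (f * k + 3 * (suc M * f)) ≡ 2 * suc M * S + (f * k + suc M * f) + 2 * suc M * f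
  regroup = ℕ-Ring.solve-∀
  collect : ∀ M S f → 2 * suc M * S + (2 * S + 2 * f) + 2 * suc M * f ≡ 2 * suc (suc M) * (S + f)
  collect = ℕ-Ring.solve-∀

∑-linear : ∀ n m (g : ℕ → ℕ) (w : ℕ → ℕ → ℕ) (τ : ℕ → ℕ) →
  ℕΣ.∑[ x < n ] (g x * ℕΣ.∑[ d < m ] (w x d * τ d)) ≡ ℕΣ.∑[ d < m ] (ℕΣ.∑[ x < n ] (g x * w x d) * τ d)
∑-linear n m g w τ = begin
  ℕΣ.∑[ x < n ] (g x * ℕΣ.∑[ d < m ] (w x d * τ d))   ≡⟨ ℕΣ.∑-cong n (λ x _ → trans (ℕΣ.*-distribˡ-∑ m (g x) (λ d → w x d * τ d))
                                                         (ℕΣ.∑-cong m (λ d _ → sym (ℕₚ.*-assoc (g x) (w x d) (τ d))))) ⟩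
  ℕΣ.∑[ x < n ] ℕΣ.∑[ d < m ] (g x * w x d * τ d)     ≡⟨ ℕΣ.∑-swap n m (λ x d → g x * w x d * τ d) ⟩
  ℕΣ.∑[ d < m ] ℕΣ.∑[ x < n ] (g x * w x d * τ d)     ≡⟨ ℕΣ.∑-cong m (λ d _ → sym (ℕΣ.*-distribʳ-∑ n (τ d) (λ x → g x * w x d))) ⟩
  ℕΣ.∑[ d < m ] (ℕΣ.∑[ x < n ] (g x * w x d) * τ d)   ∎
  where open ≡-Reasoning

∑-∑-factor : ∀ n m (w : ℕ → ℕ → ℕ) (τ : ℕ → ℕ) →
  ℕΣ.∑[ x < n ] ℕΣ.∑[ d < m ] (w x d * τ d) ≡ ℕΣ.∑[ d < m ] (ℕΣ.∑[ x < n ] w x d * τ d)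
∑-∑-factor n m w τ = trans (ℕΣ.∑-swap n m (λ x d → w x d * τ d))
                           (ℕΣ.∑-cong m (λ d _ → sym (ℕΣ.*-distribʳ-∑ n (τ d) (λ x → w x d))))

<ᵇ-punchOutℕ : ∀ c a d → c ≤ d → (d <ᵇ punchOutℕ c a) ≡ (suc d <ᵇ a)
<ᵇ-punchOutℕ c a d c≤d with c <ᵇ a in c<a
<ᵇ-punchOutℕ c (suc a) d c≤d | true  = refl
<ᵇ-punchOutℕ c a       d c≤d | false =
  trans (≥⇒<ᵇ≡false a≤d) (sym (≥⇒<ᵇ≡false (m≤n⇒m≤1+n a≤d)))
  where a≤d = ≤-trans (<ᵇ≡false⇒≥ c a c<a) c≤d

-- For a ≤ b and c ≤ d, the fourth entry lies below the first exactly when d + 1 < a.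
prefix-weight : ∀ a b c d →
  𝟙 (not (b <ᵇ a)) * (𝟙 (c <ᵇ b) * 𝟙 (not (d <ᵇ c) ∧ (d <ᵇ punchOutℕ c (punchOutℕ b a))))
    ≡ (𝟙 (c <ᵇ b) * 𝟙 (not (d <ᵇ c))) * (𝟙 (a <ᵇ suc b) * 𝟙 (suc d <ᵇ a))
prefix-weight a b c d rewrite sym (not-<ᵇ b a) with b <ᵇ a in b<a | d <ᵇ c in d<c
... | true  | d<ᵇc  = sym (zero-middle (𝟙 (c <ᵇ b) * 𝟙 (not d<ᵇc)) (𝟙 (suc d <ᵇ a)))
  where
  zero-middle : ∀ x y → x * (0 * y) ≡ 0
  zero-middle = ℕ-Ring.solve-∀
... | false | true  = killed (𝟙 (c <ᵇ b)) (𝟙 (suc d <ᵇ a))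
  where
  killed : ∀ x y → 1 * (x * 0) ≡ x * 0 * (1 * y)
  killed = ℕ-Ring.solve-∀
... | false | false rewrite <ᵇ-punchOutℕ c a d (<ᵇ≡false⇒≥ d c d<c) = kept (𝟙 (c <ᵇ b)) (𝟙 (suc d <ᵇ a))
  where
  kept : ∀ x y → 1 * (x * y) ≡ x * 1 * (1 * y)
  kept = ℕ-Ring.solve-∀

-- Expanding the first three entries writes each count as ∑_d weight d · tail d, and the
-- identity then holds weight by weight.
module Recurrence (R : SuffixProperty) (L : ℕ) (span≤L : SuffixProperty.span R ≤ L) where

  open SuffixProperty R using (span)
  open Counts R

  private
    span≤ : ∀ k → span ≤ k + L
    span≤ k = ≤-trans span≤L (ℕₚ.m≤n+m L k)

  tail : ℕ → ℕ
  tail d = completions L false d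

  weightD weightE weightP : ℕ → ℕ
  weightD d = ℕΣ.∑[ b < 3 + L ] (b ⊓ suc d)
  weightE d = ℕΣ.∑[ b < 3 + L ] (suc b * (b ⊓ suc d))
  weightP d = ℕΣ.∑[ b < 3 + L ] ((b ⊓ suc d) * (b ∸ suc d))

  completions-1 : ∀ c → completions (1 + L) true c ≡ ℕΣ.∑[ d < 1 + L ] (𝟙 (not (d <ᵇ c)) * tail d)
  completions-1 c = completions-suc L true c span≤L

  completions-2 : ∀ b → b < 3 + L → completions (2 + L) false b ≡ ℕΣ.∑[ d < 1 + L ] ((b ⊓ suc d) * tail d)
  completions-2 b (s≤s b≤2+L) = begin
    completions (2 + L) false b
      ≡⟨ completions-suc (1 + L) false b (span≤ 1) ⟩
    ℕΣ.∑[ c < 2 + L ] (𝟙 (c <ᵇ b) * completions (1 + L) true c)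
      ≡⟨ ℕΣ.∑-cong (2 + L) (λ c _ → cong (𝟙 (c <ᵇ b) *_) (completions-1 c)) ⟩
    ℕΣ.∑[ c < 2 + L ] (𝟙 (c <ᵇ b) * ℕΣ.∑[ d < 1 + L ] (𝟙 (not (d <ᵇ c)) * tail d))
      ≡⟨ ∑-linear (2 + L) (1 + L) (λ c → 𝟙 (c <ᵇ b)) (λ c d → 𝟙 (not (d <ᵇ c))) tail ⟩
    ℕΣ.∑[ d < 1 + L ] (ℕΣ.∑[ c < 2 + L ] (𝟙 (c <ᵇ b) * 𝟙 (not (d <ᵇ c))) * tail d)
      ≡⟨ ℕΣ.∑-cong (1 + L) (λ d _ → cong (_* tail d) (∑-below-and-atMost (2 + L) b d b≤2+L)) ⟩
    ℕΣ.∑[ d < 1 + L ] ((b ⊓ suc d) * tail d)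
      ∎
    where open ≡-Reasoning

  alternating-3 : alternating (3 + L) false ≡ ℕΣ.∑[ d < 1 + L ] (weightD d * tail d)
  alternating-3 = begin
    alternating (3 + L) false                                         ≡⟨ alternating-suc (2 + L) false (span≤ 2) ⟩
    ℕΣ.∑[ b < 3 + L ] completions (2 + L) false b                     ≡⟨ ℕΣ.∑-cong (3 + L) completions-2 ⟩
    ℕΣ.∑[ b < 3 + L ] ℕΣ.∑[ d < 1 + L ] ((b ⊓ suc d) * tail d)        ≡⟨ ∑-∑-factor (3 + L) (1 + L) (λ b d → b ⊓ suc d) tail ⟩
    ℕΣ.∑[ d < 1 + L ] (weightD d * tail d)                            ∎
    where open ≡-Reasoning

  alternating-4 : alternating (4 + L) true ≡ ℕΣ.∑[ d < 1 + L ] (weightE d * tail d)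
  alternating-4 = begin
    alternating (4 + L) true
      ≡⟨ alternating-suc (3 + L) true (span≤ 3) ⟩
    ℕΣ.∑[ a < 4 + L ] completions (3 + L) true a
      ≡⟨ ℕΣ.∑-cong (4 + L) (λ a _ → completions-3 a) ⟩
    ℕΣ.∑[ a < 4 + L ] ℕΣ.∑[ d < 1 + L ] (ℕΣ.∑[ b < 3 + L ] (𝟙 (not (b <ᵇ a)) * (b ⊓ suc d)) * tail d)
      ≡⟨ ∑-∑-factor (4 + L) (1 + L) (λ a d → ℕΣ.∑[ b < 3 + L ] (𝟙 (not (b <ᵇ a)) * (b ⊓ suc d))) tail ⟩
    ℕΣ.∑[ d < 1 + L ] (ℕΣ.∑[ a < 4 + L ] ℕΣ.∑[ b < 3 + L ] (𝟙 (not (b <ᵇ a)) * (b ⊓ suc d)) * tail d)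
      ≡⟨ ℕΣ.∑-cong (1 + L) (λ d _ → cong (_* tail d) (weight d)) ⟩
    ℕΣ.∑[ d < 1 + L ] (weightE d * tail d)
      ∎
    where
    open ≡-Reasoning
    completions-3 : ∀ a → completions (3 + L) true a
                            ≡ ℕΣ.∑[ d < 1 + L ] (ℕΣ.∑[ b < 3 + L ] (𝟙 (not (b <ᵇ a)) * (b ⊓ suc d)) * tail d)
    completions-3 a = trans (completions-suc (2 + L) true a (span≤ 2))
      (trans (ℕΣ.∑-cong (3 + L) (λ b b< → cong (𝟙 (not (b <ᵇ a)) *_) (completions-2 b b<)))
             (∑-linear (3 + L) (1 + L) (λ b → 𝟙 (not (b <ᵇ a))) (λ b d → b ⊓ suc d) tail))
    weight : ∀ d → ℕΣ.∑[ a < 4 + L ] ℕΣ.∑[ b < 3 + L ] (𝟙 (not (b <ᵇ a)) * (b ⊓ suc d)) ≡ weightE d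
    weight d = trans (ℕΣ.∑-swap (4 + L) (3 + L) (λ a b → 𝟙 (not (b <ᵇ a)) * (b ⊓ suc d)))
      (ℕΣ.∑-cong (3 + L) (λ b b< → trans (sym (ℕΣ.*-distribʳ-∑ (4 + L) (b ⊓ suc d) (λ a → 𝟙 (not (b <ᵇ a)))))
                                         (cong (_* (b ⊓ suc d)) (∑-atLeast (4 + L) b (m≤n⇒m≤1+n b<)))))

  below : ℕ → ℕ → ℕ → ℕ → ℕ
  below u b c d = 𝟙 (c <ᵇ b) * 𝟙 (not (d <ᵇ c) ∧ (d <ᵇ punchOutℕ c u))

  prefixWeight : ℕ → ℕ → ℕ
  prefixWeight a d = ℕΣ.∑[ b < 3 + L ] (𝟙 (not (b <ᵇ a)) * ℕΣ.∑[ c < 2 + L ] below (punchOutℕ b a) b c d)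

  completionsLess-2 : ∀ b u → completionsLess (2 + L) false b 1 u ≡ ℕΣ.∑[ d < 1 + L ] (ℕΣ.∑[ c < 2 + L ] below u b c d * tail d)
  completionsLess-2 b u = trans (completionsLess-suc (1 + L) false b 0 u (span≤ 1))
    (trans (ℕΣ.∑-cong (2 + L) (λ c _ → cong (𝟙 (c <ᵇ b) *_) (completionsLess-zero L true c (punchOutℕ c u) span≤L)))
           (∑-linear (2 + L) (1 + L) (λ c → 𝟙 (c <ᵇ b)) (λ c d → 𝟙 (not (d <ᵇ c) ∧ (d <ᵇ punchOutℕ c u))) tail))

  completionsLess-3 : ∀ a → completionsLess (3 + L) true a 2 a ≡ ℕΣ.∑[ d < 1 + L ] (prefixWeight a d * tail d)
  completionsLess-3 a = trans (completionsLess-suc (2 + L) true a 1 a (span≤ 2))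
    (trans (ℕΣ.∑-cong (3 + L) (λ b _ → cong (𝟙 (not (b <ᵇ a)) *_) (completionsLess-2 b (punchOutℕ b a))))
           (∑-linear (3 + L) (1 + L) (λ b → 𝟙 (not (b <ᵇ a))) (λ b d → ℕΣ.∑[ c < 2 + L ] below (punchOutℕ b a) b c d) tail))

  ∑-prefixWeight : ∀ d → ℕΣ.∑[ a < 4 + L ] prefixWeight a d ≡ weightP d
  ∑-prefixWeight d = begin
    ℕΣ.∑[ a < 4 + L ] ℕΣ.∑[ b < 3 + L ] (𝟙 (not (b <ᵇ a)) * ℕΣ.∑[ c < 2 + L ] below (punchOutℕ b a) b c d)
      ≡⟨ ℕΣ.∑-cong (4 + L) (λ a _ → ℕΣ.∑-cong (3 + L) (λ b _ →
           trans (ℕΣ.*-distribˡ-∑ (2 + L) (𝟙 (not (b <ᵇ a))) (λ c → below (punchOutℕ b a) b c d))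
                 (ℕΣ.∑-cong (2 + L) (λ c _ → prefix-weight a b c d)))) ⟩
    ℕΣ.∑[ a < 4 + L ] ℕΣ.∑[ b < 3 + L ] ℕΣ.∑[ c < 2 + L ] (X b c * Y a b)
      ≡⟨ ℕΣ.∑-swap (4 + L) (3 + L) (λ a b → ℕΣ.∑[ c < 2 + L ] (X b c * Y a b)) ⟩
    ℕΣ.∑[ b < 3 + L ] ℕΣ.∑[ a < 4 + L ] ℕΣ.∑[ c < 2 + L ] (X b c * Y a b)
      ≡⟨ ℕΣ.∑-cong (3 + L) inner ⟩
    weightP d
      ∎
    where
    open ≡-Reasoning
    X : ℕ → ℕ → ℕ
    X b c = 𝟙 (c <ᵇ b) * 𝟙 (not (d <ᵇ c))
    Y : ℕ → ℕ → ℕ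
    Y a b = 𝟙 (a <ᵇ suc b) * 𝟙 (suc d <ᵇ a)
    inner : ∀ b → b < 3 + L → ℕΣ.∑[ a < 4 + L ] ℕΣ.∑[ c < 2 + L ] (X b c * Y a b) ≡ (b ⊓ suc d) * (b ∸ suc d)
    inner b b< = begin
      ℕΣ.∑[ a < 4 + L ] ℕΣ.∑[ c < 2 + L ] (X b c * Y a b)   ≡⟨ ℕΣ.∑-swap (4 + L) (2 + L) (λ a c → X b c * Y a b) ⟩
      ℕΣ.∑[ c < 2 + L ] ℕΣ.∑[ a < 4 + L ] (X b c * Y a b)   ≡⟨ ℕΣ.∑-cong (2 + L) (λ c _ → trans (sym (ℕΣ.*-distribˡ-∑ (4 + L) (X b c) (λ a → Y a b)))
                                                                (cong (X b c *_) (∑-between (4 + L) (suc b) (suc d) (m≤n⇒m≤1+n b<)))) ⟩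
      ℕΣ.∑[ c < 2 + L ] (X b c * (b ∸ suc d))              ≡⟨ ℕΣ.*-distribʳ-∑ (2 + L) (b ∸ suc d) (X b) ⟨
      ℕΣ.∑[ c < 2 + L ] X b c * (b ∸ suc d)                ≡⟨ cong (_* (b ∸ suc d)) (∑-below-and-atMost (2 + L) b d (≤-pred b<)) ⟩
      (b ⊓ suc d) * (b ∸ suc d)                            ∎

  prefixed-4 : prefixed (4 + L) ≡ ℕΣ.∑[ d < 1 + L ] (weightP d * tail d)
  prefixed-4 = begin
    prefixed (4 + L)                                                   ≡⟨ prefixed-suc (3 + L) (span≤ 3) ⟩
    ℕΣ.∑[ a < 4 + L ] completionsLess (3 + L) true a 2 a               ≡⟨ ℕΣ.∑-cong (4 + L) (λ a _ → completionsLess-3 a) ⟩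
    ℕΣ.∑[ a < 4 + L ] ℕΣ.∑[ d < 1 + L ] (prefixWeight a d * tail d)    ≡⟨ ∑-∑-factor (4 + L) (1 + L) prefixWeight tail ⟩
    ℕΣ.∑[ d < 1 + L ] (ℕΣ.∑[ a < 4 + L ] prefixWeight a d * tail d)    ≡⟨ ℕΣ.∑-cong (1 + L) (λ d _ → cong (_* tail d) (∑-prefixWeight d)) ⟩
    ℕΣ.∑[ d < 1 + L ] (weightP d * tail d)                             ∎
    where open ≡-Reasoning

  prefixed-recurrence : prefixed (4 + L) + 3 * alternating (4 + L) true ≡ 2 * (4 + L) * alternating (3 + L) false
  prefixed-recurrence = begin
    prefixed (4 + L) + 3 * alternating (4 + L) true
      ≡⟨ cong₂ (λ p e → p + 3 * e) prefixed-4 alternating-4 ⟩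
    ℕΣ.∑[ d < 1 + L ] (weightP d * tail d) + 3 * ℕΣ.∑[ d < 1 + L ] (weightE d * tail d)
      ≡⟨ cong (_+_ (ℕΣ.∑[ d < 1 + L ] (weightP d * tail d))) (ℕΣ.*-distribˡ-∑ (1 + L) 3 (λ d → weightE d * tail d)) ⟩
    ℕΣ.∑[ d < 1 + L ] (weightP d * tail d) + ℕΣ.∑[ d < 1 + L ] (3 * (weightE d * tail d))
      ≡⟨ ℕΣ.∑-distrib-+ (1 + L) (λ d → weightP d * tail d) (λ d → 3 * (weightE d * tail d)) ⟨
    ℕΣ.∑[ d < 1 + L ] (weightP d * tail d + 3 * (weightE d * tail d))
      ≡⟨ ℕΣ.∑-cong (1 + L) (λ d _ → per-d d) ⟩
    ℕΣ.∑[ d < 1 + L ] (2 * (4 + L) * (weightD d * tail d))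
      ≡⟨ ℕΣ.*-distribˡ-∑ (1 + L) (2 * (4 + L)) (λ d → weightD d * tail d) ⟨
    2 * (4 + L) * ℕΣ.∑[ d < 1 + L ] (weightD d * tail d)
      ≡⟨ cong (2 * (4 + L) *_) alternating-3 ⟨
    2 * (4 + L) * alternating (3 + L) false
      ∎
    where
    open ≡-Reasoning
    factor : ∀ p e t → p * t + 3 * (e * t) ≡ (p + 3 * e) * t
    factor = ℕ-Ring.solve-∀
    weights : ∀ d → weightP d + 3 * weightE d ≡ 2 * (4 + L) * weightD d
    weights d = begin
      weightP d + 3 * weightE d
        ≡⟨ cong (_+_ (weightP d)) (ℕΣ.*-distribˡ-∑ (3 + L) 3 (λ b → suc b * (b ⊓ suc d))) ⟩
      weightP d + ℕΣ.∑[ b < 3 + L ] (3 * (suc b * (b ⊓ suc d)))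
        ≡⟨ ℕΣ.∑-distrib-+ (3 + L) (λ b → (b ⊓ suc d) * (b ∸ suc d)) (λ b → 3 * (suc b * (b ⊓ suc d))) ⟨
      ℕΣ.∑[ b < 3 + L ] ((b ⊓ suc d) * (b ∸ suc d) + 3 * (suc b * (b ⊓ suc d)))
        ≡⟨ ∑-weights (3 + L) (suc d) ⟩
      2 * (4 + L) * weightD d
        ∎
    per-d : ∀ d → weightP d * tail d + 3 * (weightE d * tail d) ≡ 2 * (4 + L) * (weightD d * tail d)
    per-d d = trans (factor (weightP d) (weightE d) (tail d))
                    (trans (cong (_* tail d) (weights d)) (ℕₚ.*-assoc (2 * (4 + L)) (weightD d) (tail d)))

open Counts anySuffix using (alternating; prefixed; completions; alternating-suc; completions-suc)
module Suffix3412 = Counts suffix3412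

prefixed≡alternating-suffix3412 : ∀ N → 4 ≤ N → prefixed N ≡ Suffix3412.alternating N (isEven N)
prefixed≡alternating-suffix3412 N 4≤N = begin
  countInjective N N Q                                      ≡⟨ countInjective-reverse N N Q ⟨
  countInjective N N (Q ∘ List.reverse)                      ≡⟨ countInjective-complement N N (Q ∘ List.reverse) ⟨
  countInjective N N (Q ∘ reverseComplement N)               ≡⟨ countInjective-cong N N (Q ∘ reverseComplement N) Q′ pointwise ⟩
  countInjective N N Q′                                      ∎
  where
  open ≡-Reasoning
  Q Q′ : List ℕ → Bool
  Q xs = altFrom true xs ∧ (fourth<first xs ∧ true)
  Q′ xs = altFrom (isEven N) xs ∧ last<fourthLast xs
  pointwise : ∀ (w : Vec (Fin N) N) → Q (reverseComplement N (values w)) ≡ Q′ (values w)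
  pointwise w = cong₂ _∧_
    (trans (altFrom-reverseComplement N (values-< w)) (cong (λ n → altFrom (isEven n) (values w)) (length-values w)))
    (trans (∧-identityʳ _) (fourth<first-reverseComplement N (subst (4 ≤_) (sym (length-values w)) 4≤N) (values-< w)))

alternating-up≡down : ∀ N → alternating N true ≡ alternating N false
alternating-up≡down N = begin
  countInjective N N up                             ≡⟨ countInjective-complement N N up ⟨
  countInjective N N (up ∘ List.map (complement N))  ≡⟨ countInjective-cong N N (up ∘ List.map (complement N)) down
                                                         (λ w → cong (_∧ true) (altFrom-complement N true (values-< w))) ⟩
  countInjective N N down                           ∎
  where
  open ≡-Reasoning
  up down : List ℕ → Bool
  up xs = altFrom true xs ∧ true
  down xs = altFrom false xs ∧ true

-- Closed form of the completion counts

binomial : ℕ → ℕ → ℕ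
binomial n       zero    = 1
binomial zero    (suc k) = 0
binomial (suc n) (suc k) = binomial n k + binomial n (suc k)

∑-binomial : ∀ t j → ℕΣ.∑[ x < t ] binomial x j ≡ binomial t (suc j)
∑-binomial zero    j = refl
∑-binomial (suc t) j = begin
  ℕΣ.∑[ x < suc t ] binomial x j          ≡⟨ ℕΣ.∑-snoc t (λ x → binomial x j) ⟩
  ℕΣ.∑[ x < t ] binomial x j + binomial t j ≡⟨ cong (_+ binomial t j) (∑-binomial t j) ⟩
  binomial t (suc j) + binomial t j       ≡⟨ ℕₚ.+-comm (binomial t (suc j)) (binomial t j) ⟩
  binomial (suc t) (suc j)                ∎
  where open ≡-Reasoning

binomial-> : ∀ n k → n < k → binomial n k ≡ 0
binomial-> zero    (suc k) _         = refl
binomial-> (suc n) (suc k) (s≤s n<k) = cong₂ _+_ (binomial-> n k n<k) (binomial-> n (suc k) (m≤n⇒m≤1+n n<k))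

binomial-diag : ∀ n → binomial n n ≡ 1
binomial-diag zero    = refl
binomial-diag (suc n) = cong₂ _+_ (binomial-diag n) (binomial-> n (suc n) ℕₚ.≤-refl)

binomial-factorials : ∀ a b → binomial (a + b) a * (a ! * b !) ≡ (a + b) !
binomial-factorials zero    b = trans (+-identityʳ (b ! + 0)) (+-identityʳ (b !))
binomial-factorials (suc a) zero
  rewrite +-identityʳ a | binomial-diag (suc a) = trans (+-identityʳ _) (ℕₚ.*-identityʳ _)
binomial-factorials (suc a) (suc b) = begin
  (binomial n a + binomial n (suc a)) * (suc a ! * suc b !)
    ≡⟨ ℕₚ.*-distribʳ-+ (suc a ! * suc b !) (binomial n a) (binomial n (suc a)) ⟩
  binomial n a * (suc a ! * suc b !) + binomial n (suc a) * (suc a ! * suc b !)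
    ≡⟨ cong₂ _+_ left right ⟩
  suc a * n ! + suc b * n !
    ≡⟨ ℕₚ.*-distribʳ-+ (n !) (suc a) (suc b) ⟨
  (suc a + suc b) * n !
    ∎
  where
  open ≡-Reasoning
  n = a + suc b
  pull : ∀ s x y z → x * (s * y * z) ≡ s * (x * (y * z))
  pull = ℕ-Ring.solve-∀
  pull′ : ∀ s x y z → x * (y * (s * z)) ≡ s * (x * (y * z))
  pull′ = ℕ-Ring.solve-∀
  left : binomial n a * (suc a ! * suc b !) ≡ suc a * n !
  left = trans (pull (suc a) (binomial n a) (a !) (suc b !)) (cong (suc a *_) (binomial-factorials a (suc b)))
  right : binomial n (suc a) * (suc a ! * suc b !) ≡ suc b * n !
  right rewrite ℕₚ.+-suc a b =
    trans (pull′ (suc b) (binomial (suc a + b) (suc a)) (suc a !) (b !)) (cong (suc b *_) (binomial-factorials (suc a) b))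

+-∑ : ∀ n (f : ℕ → ℕ) → + (ℕΣ.∑ n f) ≡ ℤΣ.∑[ i < n ] (+ f i)
+-∑ zero    f = refl
+-∑ (suc n) f = trans (ℤₚ.pos-+ (f 0) _) (cong (ℤ._+_ (+ f 0)) (+-∑ n (λ i → f (suc i))))

-‿∑ : ∀ n (f : ℕ → ℤ) → ℤ.- (ℤΣ.∑ n f) ≡ ℤΣ.∑[ i < n ] (ℤ.- f i)
-‿∑ zero    f = refl
-‿∑ (suc n) f = trans (ℤₚ.neg-distrib-+ (f 0) _) (cong (ℤ._+_ (ℤ.- f 0)) (-‿∑ n (λ i → f (suc i))))

-- k! times the k-th Taylor coefficients of cos and sin.
cosCoeff sinCoeff : ℕ → ℤ
cosCoeff zero    = + 1
cosCoeff (suc j) = ℤ.- sinCoeff j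
sinCoeff zero    = + 0
sinCoeff (suc j) = cosCoeff j

δ₀ : ℕ → ℤ
δ₀ zero    = + 1
δ₀ (suc _) = + 0

zigzag : ℕ → ℕ
zigzag n = alternating n false

κ : Bool → ℕ → ℕ → ℤ
κ false j r = cosCoeff j ℤ.* δ₀ r ℤ.+ sinCoeff j ℤ.* + zigzag r
κ true  j r = cosCoeff j ℤ.* + zigzag r ℤ.- sinCoeff j ℤ.* δ₀ r

κ-false-suc : ∀ j r → κ false (suc j) r ≡ κ true j r
κ-false-suc j r = ring (sinCoeff j) (cosCoeff j) (δ₀ r) (+ zigzag r)
  where
  ring : ∀ s c δ e → ℤ.- s ℤ.* δ ℤ.+ c ℤ.* e ≡ c ℤ.* e ℤ.- s ℤ.* δ
  ring = ℤ-Ring.solve-∀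

κ-true-suc : ∀ j r → κ true (suc j) r ≡ ℤ.- κ false j r
κ-true-suc j r = ring (sinCoeff j) (cosCoeff j) (δ₀ r) (+ zigzag r)
  where
  ring : ∀ s c δ e → ℤ.- s ℤ.* e ℤ.- c ℤ.* δ ≡ ℤ.- (c ℤ.* δ ℤ.+ s ℤ.* e)
  ring = ℤ-Ring.solve-∀

∑-expansion : ∀ N t (F : ℕ → ℕ) (c : ℕ → ℤ) → t ≤ suc N →
  (∀ x → x ≤ N → + F x ≡ ℤΣ.∑[ j < suc N ] (c j ℤ.* + binomial x j)) →
  + (ℕΣ.∑ t F) ≡ ℤΣ.∑[ j < suc N ] (c j ℤ.* + binomial t (suc j))
∑-expansion N t F c t≤ expand = begin
  + (ℕΣ.∑ t F)                                                      ≡⟨ +-∑ t F ⟩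
  ℤΣ.∑[ x < t ] (+ F x)                                             ≡⟨ ℤΣ.∑-cong t (λ x x<t → expand x (≤-pred (≤-trans x<t t≤))) ⟩
  ℤΣ.∑[ x < t ] ℤΣ.∑[ j < suc N ] (c j ℤ.* + binomial x j)          ≡⟨ ℤΣ.∑-swap t (suc N) (λ x j → c j ℤ.* + binomial x j) ⟩
  ℤΣ.∑[ j < suc N ] ℤΣ.∑[ x < t ] (c j ℤ.* + binomial x j)          ≡⟨ ℤΣ.∑-cong (suc N) (λ j _ → sym (ℤΣ.*-distribˡ-∑ t (c j) (λ x → + binomial x j))) ⟩
  ℤΣ.∑[ j < suc N ] (c j ℤ.* ℤΣ.∑[ x < t ] (+ binomial x j))        ≡⟨ ℤΣ.∑-cong (suc N) (λ j _ → cong (c j ℤ.*_)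
                                                                         (trans (sym (+-∑ t (λ x → binomial x j))) (cong +_ (∑-binomial t j)))) ⟩
  ℤΣ.∑[ j < suc N ] (c j ℤ.* + binomial t (suc j))                  ∎
  where open ≡-Reasoning

zigzag-suc : ∀ N → zigzag (suc N) ≡ ℕΣ.∑ (suc N) (completions N false)
zigzag-suc N = alternating-suc N false z≤n

completions-false-suc : ∀ N t → t ≤ suc N → completions (suc N) false t ≡ ℕΣ.∑ t (completions N true)
completions-false-suc N t t≤ = begin
  completions (suc N) false t                                   ≡⟨ completions-suc N false t z≤n ⟩
  ℕΣ.∑[ x < suc N ] (𝟙 (x <ᵇ t) * completions N true x)         ≡⟨ ∑-truncate (suc N) t (completions N true) ⟩
  ℕΣ.∑ (suc N ⊓ t) (completions N true)                         ≡⟨ cong (λ k → ℕΣ.∑ k (completions N true)) (m≥n⇒m⊓n≡n t≤) ⟩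
  ℕΣ.∑ t (completions N true)                                   ∎
  where open ≡-Reasoning

completions-true-suc : ∀ N t → t ≤ suc N → completions (suc N) true t + ℕΣ.∑ t (completions N false) ≡ zigzag (suc N)
completions-true-suc N t t≤ = begin
  completions (suc N) true t + ℕΣ.∑ t f
    ≡⟨ cong₂ _+_ (completions-suc N true t z≤n) (trans (cong (λ k → ℕΣ.∑ k f) (sym (m≥n⇒m⊓n≡n t≤))) (sym (∑-truncate (suc N) t f))) ⟩
  ℕΣ.∑[ x < suc N ] (𝟙 (not (x <ᵇ t)) * f x) + ℕΣ.∑[ x < suc N ] (𝟙 (x <ᵇ t) * f x)
    ≡⟨ ℕΣ.∑-distrib-+ (suc N) (λ x → 𝟙 (not (x <ᵇ t)) * f x) (λ x → 𝟙 (x <ᵇ t) * f x) ⟨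
  ℕΣ.∑[ x < suc N ] (𝟙 (not (x <ᵇ t)) * f x + 𝟙 (x <ᵇ t) * f x)
    ≡⟨ ℕΣ.∑-cong (suc N) (λ x _ → trans (sym (ℕₚ.*-distribʳ-+ (f x) (𝟙 (not (x <ᵇ t))) _))
                                        (trans (cong (_* f x) (𝟙-not (x <ᵇ t))) (ℕₚ.*-identityˡ (f x)))) ⟩
  ℕΣ.∑ (suc N) f
    ≡⟨ zigzag-suc N ⟨
  zigzag (suc N)
    ∎
  where
  open ≡-Reasoning
  f = completions N false

κ-true-zero : ∀ r → κ true 0 r ≡ + zigzag r
κ-true-zero r = ring (+ zigzag r) (δ₀ r)
  where
  ring : ∀ e δ → + 1 ℤ.* e ℤ.- + 0 ℤ.* δ ≡ e
  ring = ℤ-Ring.solve-∀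

closedForm : ∀ N d t → t ≤ N → + completions N d t ≡ ℤΣ.∑[ j < suc N ] (κ d j (N ∸ j) ℤ.* + binomial t j)
closedForm zero    false zero z≤n = refl
closedForm zero    true  zero z≤n = refl
closedForm (suc N) false t t≤ = begin
  + completions (suc N) false t                                              ≡⟨ cong +_ (completions-false-suc N t t≤) ⟩
  + (ℕΣ.∑ t (completions N true))                                            ≡⟨ ∑-expansion N t (completions N true) (λ j → κ true j (N ∸ j)) t≤ (closedForm N true) ⟩
  ℤΣ.∑[ j < suc N ] (κ true j (N ∸ j) ℤ.* + binomial t (suc j))              ≡⟨ ℤΣ.∑-cong (suc N) (λ j _ →
                                                                                  cong (ℤ._* + binomial t (suc j)) (κ-false-suc j (N ∸ j))) ⟨
  ℤΣ.∑[ j < suc N ] (κ false (suc j) (N ∸ j) ℤ.* + binomial t (suc j))       ≡⟨ ℤₚ.+-identityˡ _ ⟨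
  ℤΣ.∑[ j < suc (suc N) ] (κ false j (suc N ∸ j) ℤ.* + binomial t j)         ∎
  where open ≡-Reasoning
closedForm (suc N) true t t≤ = begin
  + completions (suc N) true t
    ≡⟨ difference (completions-true-suc N t t≤) ⟩
  + zigzag (suc N) ℤ.- + (ℕΣ.∑ t (completions N false))
    ≡⟨ cong₂ ℤ._-_ (sym (ℤₚ.*-identityʳ (+ zigzag (suc N)))) (∑-expansion N t (completions N false) (λ j → κ false j (N ∸ j)) t≤ (closedForm N false)) ⟩
  + zigzag (suc N) ℤ.* + 1 ℤ.- ℤΣ.∑[ j < suc N ] (κ false j (N ∸ j) ℤ.* + binomial t (suc j))
    ≡⟨ cong₂ ℤ._+_ (cong (ℤ._* + 1) (sym (κ-true-zero (suc N))))
                   (trans (-‿∑ (suc N) (λ j → κ false j (N ∸ j) ℤ.* + binomial t (suc j)))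
                          (ℤΣ.∑-cong (suc N) (λ j _ → trans (ℤₚ.neg-distribˡ-* (κ false j (N ∸ j)) _)
                                                            (cong (ℤ._* + binomial t (suc j)) (sym (κ-true-suc j (N ∸ j))))))) ⟩
  ℤΣ.∑[ j < suc (suc N) ] (κ true j (suc N ∸ j) ℤ.* + binomial t j)
    ∎
  where
  open ≡-Reasoning
  difference : ∀ {a b c} → a + b ≡ c → + a ≡ + c ℤ.- + b
  difference {a} {b} refl = trans (cancel (+ a) (+ b)) (cong (ℤ._- + b) (sym (ℤₚ.pos-+ a b)))
    where
    cancel : ∀ x y → x ≡ x ℤ.+ y ℤ.- y
    cancel = ℤ-Ring.solve-∀

zigzag-expansion : ∀ N → + zigzag (suc N) ≡ ℤΣ.∑[ j < suc N ] (κ false j (N ∸ j) ℤ.* + binomial (suc N) (suc j))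
zigzag-expansion N = trans (cong +_ (zigzag-suc N))
  (∑-expansion N (suc N) (completions N false) (λ j → κ false j (N ∸ j)) ℕₚ.≤-refl (closedForm N false))

isEven-+ : ∀ x y → isEven (x + y) ≡ (isEven x ==ᵇ isEven y)
isEven-+ zero    y = refl
isEven-+ (suc x) y = trans (cong not (isEven-+ x y)) (not-==ᵇ (isEven x) (isEven y))
  where
  not-==ᵇ : ∀ a b → not (a ==ᵇ b) ≡ (not a ==ᵇ b)
  not-==ᵇ true  b = refl
  not-==ᵇ false b = not-involutive b

isEven-+∸ : ∀ {j k} → j ≤ k → isEven (j + (k ∸ j)) ≡ isEven k
isEven-+∸ j≤k = cong isEven (ℕₚ.m+[n∸m]≡n j≤k)

isEven-2* : ∀ j → isEven (2 * j) ≡ true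
isEven-2* j = trans (isEven-+ j (j + 0)) (trans (cong (λ x → isEven j ==ᵇ isEven x) (+-identityʳ j)) (==ᵇ-refl (isEven j)))
  where
  ==ᵇ-refl : ∀ b → (b ==ᵇ b) ≡ true
  ==ᵇ-refl true  = refl
  ==ᵇ-refl false = refl

cosCoeff-odd : ∀ j → isEven j ≡ false → cosCoeff j ≡ + 0
sinCoeff-even : ∀ j → isEven j ≡ true → sinCoeff j ≡ + 0
cosCoeff-odd (suc j) odd = cong ℤ.-_ (sinCoeff-even j (not-injective odd))
sinCoeff-even zero    _    = refl
sinCoeff-even (suc j) even = cosCoeff-odd j (not-injective even)

parity : ∀ j r {a b} → isEven j ≡ a → isEven r ≡ b → isEven (j + r) ≡ (a ==ᵇ b)
parity j r refl refl = isEven-+ j r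

false≢true : false ≢ true
false≢true ()

δ₀-odd : ∀ r → isEven r ≡ false → δ₀ r ≡ + 0
δ₀-odd (suc r) _ = refl

secCoeff : ℕ → ℤ
secCoeff r = if isEven r then + zigzag r else + 0

κ-odd : ∀ j r → isEven (j + r) ≡ false → κ false j r ≡ sinCoeff j ℤ.* secCoeff r
κ-odd j r odd with isEven j in j-even | isEven r in r-even
... | true  | true  = ⊥-elim (false≢true (trans (sym odd) (parity j r j-even r-even)))
... | false | false = ⊥-elim (false≢true (trans (sym odd) (parity j r j-even r-even)))
... | true  | false rewrite sinCoeff-even j j-even | δ₀-odd r r-even = vanish (cosCoeff j) (+ zigzag r)
  where
  vanish : ∀ c e → c ℤ.* + 0 ℤ.+ + 0 ℤ.* e ≡ + 0
  vanish = ℤ-Ring.solve-∀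
... | false | true  rewrite cosCoeff-odd j j-even = drop-cos (δ₀ r) (sinCoeff j) (+ zigzag r)
  where
  drop-cos : ∀ δ s e → + 0 ℤ.* δ ℤ.+ s ℤ.* e ≡ s ℤ.* e
  drop-cos = ℤ-Ring.solve-∀

sinCoeff*secCoeff-even : ∀ j r → isEven (j + r) ≡ true → sinCoeff j ℤ.* secCoeff r ≡ + 0
sinCoeff*secCoeff-even j r even with isEven j in j-even | isEven r in r-even
... | true  | _     rewrite sinCoeff-even j j-even = refl
... | false | false = ℤₚ.*-zeroʳ (sinCoeff j)
... | false | true  = ⊥-elim (false≢true (trans (sym (parity j r j-even r-even)) even))

secCoeff-suc : ∀ k → secCoeff (suc k) ≡ ℤ.- ℤΣ.∑[ j < suc k ] (cosCoeff (suc j) ℤ.* secCoeff (k ∸ j) ℤ.* + binomial (suc k) (suc j))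
secCoeff-suc k = trans (by-parity (isEven k) refl) (sym (trans (-‿∑ (suc k) cosTerm) (ℤΣ.∑-cong (suc k) (λ j _ →
  flip-sign (sinCoeff j) (secCoeff (k ∸ j)) (+ binomial (suc k) (suc j))))))
  where
  cosTerm sinTerm : ℕ → ℤ
  cosTerm j = cosCoeff (suc j) ℤ.* secCoeff (k ∸ j) ℤ.* + binomial (suc k) (suc j)
  sinTerm j = sinCoeff j ℤ.* secCoeff (k ∸ j) ℤ.* + binomial (suc k) (suc j)
  flip-sign : ∀ s x c → ℤ.- (ℤ.- s ℤ.* x ℤ.* c) ≡ s ℤ.* x ℤ.* c
  flip-sign = ℤ-Ring.solve-∀
  by-parity : ∀ b → isEven k ≡ b → secCoeff (suc k) ≡ ℤΣ.∑ (suc k) sinTerm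
  by-parity true  k-even rewrite k-even = sym (trans (ℤΣ.∑-cong (suc k) (λ j j< →
    cong (ℤ._* + binomial (suc k) (suc j)) (sinCoeff*secCoeff-even j (k ∸ j) (trans (isEven-+∸ (≤-pred j<)) k-even))))
    (ℤΣ.∑-zero (suc k)))
  by-parity false k-odd rewrite k-odd = trans (zigzag-expansion k) (ℤΣ.∑-cong (suc k) (λ j j< →
    cong (ℤ._* + binomial (suc k) (suc j)) (κ-odd j (k ∸ j) (trans (isEven-+∸ (≤-pred j<)) k-odd))))

sin-sec-convolution : ∀ M → isEven M ≡ false →
  ℤΣ.∑[ i < suc M ] (sinCoeff i ℤ.* secCoeff (M ∸ i) ℤ.* + binomial M i) ≡ + completions M false M
sin-sec-convolution M M-odd = sym (trans (closedForm M false M ℕₚ.≤-refl) (ℤΣ.∑-cong (suc M) (λ i i< →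
  cong (ℤ._* + binomial M i) (κ-odd i (M ∸ i) (trans (isEven-+∸ (≤-pred i<)) M-odd)))))

-- Exponential generating functions

fromℤ : ℤ → ℚ
fromℤ z = z / 1

private
  fromℤ≡mkℚ : ∀ z → fromℤ z ≡ mkℚ z 0 (Coprime.sym (1-coprimeTo _))
  fromℤ≡mkℚ z = ℚₚ.↥p/↧p≡p (mkℚ z 0 (Coprime.sym (1-coprimeTo _)))

fromℤ-+ : ∀ a b → fromℤ (a ℤ.+ b) ≡ fromℤ a ℚ.+ fromℤ b
fromℤ-+ a b rewrite fromℤ≡mkℚ a | fromℤ≡mkℚ b =
  cong (_/ 1) (sym (cong₂ ℤ._+_ (ℤₚ.*-identityʳ a) (ℤₚ.*-identityʳ b)))

fromℤ-* : ∀ a b → fromℤ (a ℤ.* b) ≡ fromℤ a ℚ.* fromℤ b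
fromℤ-* a b rewrite fromℤ≡mkℚ a | fromℤ≡mkℚ b = refl

fromℤ-neg : ∀ a → fromℤ (ℤ.- a) ≡ ℚ.- fromℤ a
fromℤ-neg a rewrite fromℤ≡mkℚ (ℤ.- a) | fromℤ≡mkℚ a = neg-mkℚ a
  where
  neg-mkℚ : ∀ a → mkℚ (ℤ.- a) 0 (Coprime.sym (1-coprimeTo _)) ≡ ℚ.- mkℚ a 0 (Coprime.sym (1-coprimeTo _))
  neg-mkℚ (+ zero) = refl
  neg-mkℚ +[1+ n ] = refl
  neg-mkℚ -[1+ n ] = refl

fromℤ-*-1/ : ∀ n .{{_ : ℕ.NonZero n}} → fromℤ (+ n) ℚ.* (+ 1 / n) ≡ 1ℚ
fromℤ-*-1/ (suc k) rewrite fromℤ≡mkℚ (+ suc k) =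
  trans (cong (mkℚ (+ suc k) 0 (Coprime.sym (1-coprimeTo _)) ℚ.*_) (ℚₚ.↥p/↧p≡p (mkℚ (+ 1) k (1-coprimeTo _))))
        (ℚₚ.*-inverseʳ (mkℚ (+ suc k) 0 (Coprime.sym (1-coprimeTo _))))

fromℤ-ℕ* : ∀ m n → fromℤ (+ (m * n)) ≡ fromℤ (+ m) ℚ.* fromℤ (+ n)
fromℤ-ℕ* m n = trans (cong fromℤ (ℤₚ.pos-* m n)) (fromℤ-* (+ m) (+ n))

factorial-*-invFact : ∀ n → fromℤ (+ (n !)) ℚ.* invFact n ≡ 1ℚ
factorial-*-invFact n = fromℤ-*-1/ (n !) {{n ℕₚ.!≢0}}

invFact-* : ∀ a b → invFact a ℚ.* invFact b ≡ fromℤ (+ binomial (a + b) a) ℚ.* invFact (a + b)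
invFact-* a b = begin
  iA ℚ.* iB                                      ≡⟨ ℚₚ.*-identityʳ (iA ℚ.* iB) ⟨
  iA ℚ.* iB ℚ.* 1ℚ                               ≡⟨ cong (iA ℚ.* iB ℚ.*_) (factorial-*-invFact (a + b)) ⟨
  iA ℚ.* iB ℚ.* (fromℤ (+ ((a + b) !)) ℚ.* iN)  ≡⟨ cong (λ m → iA ℚ.* iB ℚ.* (fromℤ (+ m) ℚ.* iN)) (binomial-factorials a b) ⟨
  iA ℚ.* iB ℚ.* (fromℤ (+ (c * (a ! * b !))) ℚ.* iN)
    ≡⟨ cong (λ q → iA ℚ.* iB ℚ.* (q ℚ.* iN)) (trans (fromℤ-ℕ* c (a ! * b !)) (cong (fromℤ (+ c) ℚ.*_) (fromℤ-ℕ* (a !) (b !)))) ⟩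
  iA ℚ.* iB ℚ.* (fromℤ (+ c) ℚ.* (A ℚ.* B) ℚ.* iN)
    ≡⟨ regroup iA iB (fromℤ (+ c)) A B iN ⟩
  fromℤ (+ c) ℚ.* iN ℚ.* ((A ℚ.* iA) ℚ.* (B ℚ.* iB))
    ≡⟨ cong₂ (λ x y → fromℤ (+ c) ℚ.* iN ℚ.* (x ℚ.* y)) (factorial-*-invFact a) (factorial-*-invFact b) ⟩
  fromℤ (+ c) ℚ.* iN ℚ.* (1ℚ ℚ.* 1ℚ)
    ≡⟨ ℚₚ.*-identityʳ (fromℤ (+ c) ℚ.* iN) ⟩
  fromℤ (+ c) ℚ.* iN
    ∎
  where
  open ≡-Reasoning
  iA = invFact a
  iB = invFact b
  iN = invFact (a + b)
  A = fromℤ (+ (a !))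
  B = fromℤ (+ (b !))
  c = binomial (a + b) a
  regroup : ∀ iA iB C A B iN → iA ℚ.* iB ℚ.* (C ℚ.* (A ℚ.* B) ℚ.* iN) ≡ C ℚ.* iN ℚ.* ((A ℚ.* iA) ℚ.* (B ℚ.* iB))
  regroup = solve 6 (λ iA iB C A B iN → iA :* iB :* (C :* (A :* B) :* iN) := C :* iN :* ((A :* iA) :* (B :* iB))) refl
    where open ℚ-Solver

sumℚ-applyUpTo : ∀ n (f : ℕ → ℚ) → sumℚ (applyUpTo f n) ≡ ℚΣ.∑ n f
sumℚ-applyUpTo zero    f = refl
sumℚ-applyUpTo (suc n) f = cong (f 0 ℚ.+_) (sumℚ-applyUpTo n (λ i → f (suc i)))

⊛-∑ : ∀ (f g : Series) k → (f ⊛ g) k ≡ ℚΣ.∑[ i < suc k ] (f i ℚ.* g (k ∸ i))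
⊛-∑ f g k = trans (cong sumℚ (map-upTo (λ i → f i ℚ.* g (k ∸ i)) (suc k))) (sumℚ-applyUpTo (suc k) (λ i → f i ℚ.* g (k ∸ i)))

invRev≡applyUpTo : ∀ (f : Series) k → invRev f k ≡ applyUpTo (λ i → invS f (k ∸ i)) (suc k)
invRev≡applyUpTo f zero    = refl
invRev≡applyUpTo f (suc k) = cong (invS f (suc k) ∷_) (invRev≡applyUpTo f k)

zipWith-applyUpTo : ∀ (h : ℚ → ℚ → ℚ) (f g : ℕ → ℚ) n →
  zipWith h (applyUpTo f n) (applyUpTo g n) ≡ applyUpTo (λ i → h (f i) (g i)) n
zipWith-applyUpTo h f g zero    = refl
zipWith-applyUpTo h f g (suc n) = cong (h (f 0) (g 0) ∷_) (zipWith-applyUpTo h (λ i → f (suc i)) (λ i → g (suc i)) n)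

invS-suc : ∀ (f : Series) k → invS f (suc k) ≡ ℚ.- ℚΣ.∑[ j < suc k ] (f (suc j) ℚ.* invS f (k ∸ j))
invS-suc f k = cong ℚ.-_ (trans (cong sumℚ (begin
  zipWith ℚ._*_ (List.map (λ j → f (suc j)) (upTo (suc k))) (invRev f k)
    ≡⟨ cong₂ (zipWith ℚ._*_) (map-upTo (λ j → f (suc j)) (suc k)) (invRev≡applyUpTo f k) ⟩
  zipWith ℚ._*_ (applyUpTo (λ j → f (suc j)) (suc k)) (applyUpTo (λ j → invS f (k ∸ j)) (suc k))
    ≡⟨ zipWith-applyUpTo ℚ._*_ (λ j → f (suc j)) (λ j → invS f (k ∸ j)) (suc k) ⟩
  applyUpTo (λ j → f (suc j) ℚ.* invS f (k ∸ j)) (suc k)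
    ∎)) (sumℚ-applyUpTo (suc k) (λ j → f (suc j) ℚ.* invS f (k ∸ j))))
  where open ≡-Reasoning

fromℤ-∑-* : ∀ n (h : ℕ → ℤ) c → ℚΣ.∑[ i < n ] (fromℤ (h i) ℚ.* c) ≡ fromℤ (ℤΣ.∑ n h) ℚ.* c
fromℤ-∑-* zero    h c = sym (ℚₚ.*-zeroˡ c)
fromℤ-∑-* (suc n) h c = begin
  fromℤ (h 0) ℚ.* c ℚ.+ ℚΣ.∑[ i < n ] (fromℤ (h (suc i)) ℚ.* c)  ≡⟨ cong (fromℤ (h 0) ℚ.* c ℚ.+_) (fromℤ-∑-* n (λ i → h (suc i)) c) ⟩
  fromℤ (h 0) ℚ.* c ℚ.+ fromℤ (ℤΣ.∑ n (λ i → h (suc i))) ℚ.* c  ≡⟨ ℚₚ.*-distribʳ-+ c (fromℤ (h 0)) _ ⟨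
  (fromℤ (h 0) ℚ.+ fromℤ (ℤΣ.∑ n (λ i → h (suc i)))) ℚ.* c      ≡⟨ cong (ℚ._* c) (fromℤ-+ (h 0) _) ⟨
  fromℤ (ℤΣ.∑ (suc n) h) ℚ.* c                                  ∎
  where open ≡-Reasoning

egf-product : ∀ k i (a b : ℤ) → i ≤ k →
  (fromℤ a ℚ.* invFact i) ℚ.* (fromℤ b ℚ.* invFact (k ∸ i)) ≡ fromℤ (a ℤ.* b ℤ.* + binomial k i) ℚ.* invFact k
egf-product k i a b i≤k = begin
  (fromℤ a ℚ.* invFact i) ℚ.* (fromℤ b ℚ.* invFact (k ∸ i))
    ≡⟨ regroup (fromℤ a) (fromℤ b) (invFact i) (invFact (k ∸ i)) ⟩
  (fromℤ a ℚ.* fromℤ b) ℚ.* (invFact i ℚ.* invFact (k ∸ i))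
    ≡⟨ cong₂ ℚ._*_ (sym (fromℤ-* a b)) (invFact-* i (k ∸ i)) ⟩
  fromℤ (a ℤ.* b) ℚ.* (fromℤ (+ binomial (i + (k ∸ i)) i) ℚ.* invFact (i + (k ∸ i)))
    ≡⟨ cong (λ n → fromℤ (a ℤ.* b) ℚ.* (fromℤ (+ binomial n i) ℚ.* invFact n)) (ℕₚ.m+[n∸m]≡n i≤k) ⟩
  fromℤ (a ℤ.* b) ℚ.* (fromℤ (+ binomial k i) ℚ.* invFact k)
    ≡⟨ ℚₚ.*-assoc (fromℤ (a ℤ.* b)) _ _ ⟨
  fromℤ (a ℤ.* b) ℚ.* fromℤ (+ binomial k i) ℚ.* invFact k
    ≡⟨ cong (ℚ._* invFact k) (fromℤ-* (a ℤ.* b) (+ binomial k i)) ⟨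
  fromℤ (a ℤ.* b ℤ.* + binomial k i) ℚ.* invFact k
    ∎
  where
  open ≡-Reasoning
  regroup : ∀ x y u v → (x ℚ.* u) ℚ.* (y ℚ.* v) ≡ (x ℚ.* y) ℚ.* (u ℚ.* v)
  regroup = solve 4 (λ x y u v → (x :* u) :* (y :* v) := (x :* y) :* (u :* v)) refl
    where open ℚ-Solver

egf-convolution : ∀ k (a b : ℕ → ℤ) →
  ℚΣ.∑[ i < suc k ] ((fromℤ (a i) ℚ.* invFact i) ℚ.* (fromℤ (b (k ∸ i)) ℚ.* invFact (k ∸ i)))
    ≡ fromℤ (ℤΣ.∑[ i < suc k ] (a i ℤ.* b (k ∸ i) ℤ.* + binomial k i)) ℚ.* invFact k
egf-convolution k a b = trans (ℚΣ.∑-cong (suc k) (λ i i< → egf-product k i (a i) (b (k ∸ i)) (≤-pred i<)))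
                              (fromℤ-∑-* (suc k) (λ i → a i ℤ.* b (k ∸ i) ℤ.* + binomial k i) (invFact k))

half-suc-even : ∀ j → isEven j ≡ true → ℕ.⌊ suc j /2⌋ ≡ ℕ.⌊ j /2⌋
half-suc-odd : ∀ j → isEven j ≡ false → ℕ.⌊ suc j /2⌋ ≡ suc ℕ.⌊ j /2⌋
half-suc-even zero          _    = refl
half-suc-even (suc (suc j)) even = cong suc (half-suc-even j (not-injective (not-injective even)))
half-suc-odd (suc zero)    _    = refl
half-suc-odd (suc (suc j)) odd  = cong suc (half-suc-odd j (not-injective (not-injective odd)))

fromℤ-cosCoeff : ∀ k → fromℤ (cosCoeff k) ≡ (if isEven k then sgn ℕ.⌊ k /2⌋ else 0ℚ)
fromℤ-sinCoeff : ∀ k → fromℤ (sinCoeff k) ≡ (if isEven k then 0ℚ else sgn ℕ.⌊ k /2⌋)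
fromℤ-cosCoeff zero    = refl
fromℤ-cosCoeff (suc k) with isEven k in k-even | fromℤ-sinCoeff k
... | true  | sin≡ = trans (fromℤ-neg (sinCoeff k)) (cong ℚ.-_ sin≡)
... | false | sin≡ rewrite half-suc-odd k k-even = trans (fromℤ-neg (sinCoeff k)) (cong ℚ.-_ sin≡)
fromℤ-sinCoeff zero    = refl
fromℤ-sinCoeff (suc k) with isEven k in k-even | fromℤ-cosCoeff k
... | true  | cos≡ rewrite half-suc-even k k-even = cos≡
... | false | cos≡ = cos≡

cosS-coeff : ∀ k → cosS k ≡ fromℤ (cosCoeff k) ℚ.* invFact k
cosS-coeff k rewrite fromℤ-cosCoeff k with isEven k
... | true  = refl
... | false = sym (ℚₚ.*-zeroˡ (invFact k))

sinS-coeff : ∀ k → sinS k ≡ fromℤ (sinCoeff k) ℚ.* invFact k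
sinS-coeff k rewrite fromℤ-sinCoeff k with isEven k
... | true  = sym (ℚₚ.*-zeroˡ (invFact k))
... | false = refl

secS-coeff : ∀ k → secS k ≡ fromℤ (secCoeff k) ℚ.* invFact k
secS-coeff k = bounded k k ℕₚ.≤-refl
  where
  bounded : ∀ n k → k ≤ n → secS k ≡ fromℤ (secCoeff k) ℚ.* invFact k
  bounded n       zero    _             = refl
  bounded (suc n) (suc k) (s≤s k≤n) = begin
    secS (suc k)
      ≡⟨ invS-suc cosS k ⟩
    ℚ.- ℚΣ.∑[ j < suc k ] (cosS (suc j) ℚ.* secS (k ∸ j))
      ≡⟨ cong ℚ.-_ (ℚΣ.∑-cong (suc k) (λ j j< → trans
           (cong₂ ℚ._*_ (cosS-coeff (suc j)) (bounded n (k ∸ j) (≤-trans (m∸n≤m k j) k≤n)))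
           (egf-product (suc k) (suc j) (cosCoeff (suc j)) (secCoeff (k ∸ j)) j<))) ⟩
    ℚ.- ℚΣ.∑[ j < suc k ] (fromℤ (term j) ℚ.* invFact (suc k))
      ≡⟨ cong ℚ.-_ (fromℤ-∑-* (suc k) term (invFact (suc k))) ⟩
    ℚ.- (fromℤ (ℤΣ.∑ (suc k) term) ℚ.* invFact (suc k))
      ≡⟨ ℚₚ.neg-distribˡ-* (fromℤ (ℤΣ.∑ (suc k) term)) (invFact (suc k)) ⟩
    ℚ.- fromℤ (ℤΣ.∑ (suc k) term) ℚ.* invFact (suc k)
      ≡⟨ cong (ℚ._* invFact (suc k)) (trans (sym (fromℤ-neg (ℤΣ.∑ (suc k) term))) (cong fromℤ (sym (secCoeff-suc k)))) ⟩
    fromℤ (secCoeff (suc k)) ℚ.* invFact (suc k)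
      ∎
    where
    open ≡-Reasoning
    term : ℕ → ℤ
    term j = cosCoeff (suc j) ℤ.* secCoeff (k ∸ j) ℤ.* + binomial (suc k) (suc j)

sinS⊛secS : ∀ M → isEven M ≡ false → (sinS ⊛ secS) M ≡ fromℤ (+ completions M false M) ℚ.* invFact M
sinS⊛secS M M-odd = begin
  (sinS ⊛ secS) M
    ≡⟨ ⊛-∑ sinS secS M ⟩
  ℚΣ.∑[ i < suc M ] (sinS i ℚ.* secS (M ∸ i))
    ≡⟨ ℚΣ.∑-cong (suc M) (λ i _ → cong₂ ℚ._*_ (sinS-coeff i) (secS-coeff (M ∸ i))) ⟩
  ℚΣ.∑[ i < suc M ] ((fromℤ (sinCoeff i) ℚ.* invFact i) ℚ.* (fromℤ (secCoeff (M ∸ i)) ℚ.* invFact (M ∸ i)))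
    ≡⟨ egf-convolution M sinCoeff secCoeff ⟩
  fromℤ (ℤΣ.∑[ i < suc M ] (sinCoeff i ℤ.* secCoeff (M ∸ i) ℤ.* + binomial M i)) ℚ.* invFact M
    ≡⟨ cong (λ z → fromℤ z ℚ.* invFact M) (sin-sec-convolution M M-odd) ⟩
  fromℤ (+ completions M false M) ℚ.* invFact M
    ∎
  where open ≡-Reasoning

⊛-distribʳ-⊕ : ∀ (f h g : Series) k → ((f ⊕ h) ⊛ g) k ≡ (f ⊛ g) k ℚ.+ (h ⊛ g) k
⊛-distribʳ-⊕ f h g k = begin
  ((f ⊕ h) ⊛ g) k
    ≡⟨ ⊛-∑ (f ⊕ h) g k ⟩
  ℚΣ.∑[ i < suc k ] ((f i ℚ.+ h i) ℚ.* g (k ∸ i))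
    ≡⟨ ℚΣ.∑-cong (suc k) (λ i _ → ℚₚ.*-distribʳ-+ (g (k ∸ i)) (f i) (h i)) ⟩
  ℚΣ.∑[ i < suc k ] (f i ℚ.* g (k ∸ i) ℚ.+ h i ℚ.* g (k ∸ i))
    ≡⟨ ℚΣ.∑-distrib-+ (suc k) (λ i → f i ℚ.* g (k ∸ i)) (λ i → h i ℚ.* g (k ∸ i)) ⟩
  ℚΣ.∑[ i < suc k ] (f i ℚ.* g (k ∸ i)) ℚ.+ ℚΣ.∑[ i < suc k ] (h i ℚ.* g (k ∸ i))
    ≡⟨ cong₂ ℚ._+_ (⊛-∑ f g k) (⊛-∑ h g k) ⟨
  (f ⊛ g) k ℚ.+ (h ⊛ g) k
    ∎
  where open ≡-Reasoning

⊛-·ₛ : ∀ c (f g : Series) k → ((c ·ₛ f) ⊛ g) k ≡ c ℚ.* (f ⊛ g) k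
⊛-·ₛ c f g k = begin
  ((c ·ₛ f) ⊛ g) k                                   ≡⟨ ⊛-∑ (c ·ₛ f) g k ⟩
  ℚΣ.∑[ i < suc k ] (c ℚ.* f i ℚ.* g (k ∸ i))         ≡⟨ ℚΣ.∑-cong (suc k) (λ i _ → ℚₚ.*-assoc c (f i) (g (k ∸ i))) ⟩
  ℚΣ.∑[ i < suc k ] (c ℚ.* (f i ℚ.* g (k ∸ i)))       ≡⟨ ℚΣ.*-distribˡ-∑ (suc k) c (λ i → f i ℚ.* g (k ∸ i)) ⟨
  c ℚ.* ℚΣ.∑[ i < suc k ] (f i ℚ.* g (k ∸ i))         ≡⟨ cong (c ℚ.*_) (⊛-∑ f g k) ⟨
  c ℚ.* (f ⊛ g) k                                    ∎
  where open ≡-Reasoning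

∑-0* : ∀ n (f : ℕ → ℚ) → ℚΣ.∑[ i < n ] (0ℚ ℚ.* f i) ≡ 0ℚ
∑-0* n f = trans (ℚΣ.∑-cong n (λ i _ → ℚₚ.*-zeroˡ (f i))) (ℚΣ.∑-zero n)

constS-⊛ : ∀ c (g : Series) k → (constS c ⊛ g) k ≡ c ℚ.* g k
constS-⊛ c g k = trans (⊛-∑ (constS c) g k)
  (trans (cong (c ℚ.* g k ℚ.+_) (∑-0* k (λ i → g (k ∸ suc i)))) (ℚₚ.+-identityʳ (c ℚ.* g k)))

xS-⊛-zero : ∀ (f : Series) → (xS ⊛ f) 0 ≡ 0ℚ
xS-⊛-zero f = trans (⊛-∑ xS f 0) (trans (ℚₚ.+-identityʳ (0ℚ ℚ.* f 0)) (ℚₚ.*-zeroˡ (f 0)))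

xS-⊛-suc : ∀ (f : Series) i → (xS ⊛ f) (suc i) ≡ f i
xS-⊛-suc f i = begin
  (xS ⊛ f) (suc i)                                                        ≡⟨ ⊛-∑ xS f (suc i) ⟩
  0ℚ ℚ.* f (suc i) ℚ.+ (1ℚ ℚ.* f i ℚ.+ ℚΣ.∑[ j < i ] (0ℚ ℚ.* f (i ∸ suc j))) ≡⟨ cong₂ ℚ._+_ (ℚₚ.*-zeroˡ (f (suc i)))
                                                                               (cong₂ ℚ._+_ (ℚₚ.*-identityˡ (f i)) (∑-0* i (λ j → f (i ∸ suc j)))) ⟩
  0ℚ ℚ.+ (f i ℚ.+ 0ℚ)                                                      ≡⟨ trans (ℚₚ.+-identityˡ (f i ℚ.+ 0ℚ)) (ℚₚ.+-identityʳ (f i)) ⟩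
  f i                                                                     ∎
  where open ≡-Reasoning

xS-⊛-⊛-suc : ∀ (f g : Series) k → ((xS ⊛ f) ⊛ g) (suc k) ≡ (f ⊛ g) k
xS-⊛-⊛-suc f g k = begin
  ((xS ⊛ f) ⊛ g) (suc k)                                                          ≡⟨ ⊛-∑ (xS ⊛ f) g (suc k) ⟩
  (xS ⊛ f) 0 ℚ.* g (suc k) ℚ.+ ℚΣ.∑[ i < suc k ] ((xS ⊛ f) (suc i) ℚ.* g (k ∸ i))   ≡⟨ cong₂ ℚ._+_
                                                                                       (trans (cong (ℚ._* g (suc k)) (xS-⊛-zero f)) (ℚₚ.*-zeroˡ (g (suc k))))
                                                                                       (ℚΣ.∑-cong (suc k) (λ i _ → cong (ℚ._* g (k ∸ i)) (xS-⊛-suc f i))) ⟩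
  0ℚ ℚ.+ ℚΣ.∑[ i < suc k ] (f i ℚ.* g (k ∸ i))                                     ≡⟨ ℚₚ.+-identityˡ _ ⟩
  ℚΣ.∑[ i < suc k ] (f i ℚ.* g (k ∸ i))                                            ≡⟨ ⊛-∑ f g k ⟨
  (f ⊛ g) k                                                                       ∎
  where open ≡-Reasoning

targetS-coeff : ∀ m′ → isEven m′ ≡ true →
  targetS (2 + m′) ≡
    (fromℤ (+ 4) ℚ.* (fromℤ (secCoeff m′) ℚ.* invFact m′)
      ℚ.+ ℚ.- fromℤ (+ 12) ℚ.* (fromℤ (+ completions (1 + m′) false (1 + m′)) ℚ.* invFact (1 + m′)))
      ℚ.+ fromℤ (+ 9) ℚ.* (fromℤ (secCoeff (2 + m′)) ℚ.* invFact (2 + m′))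
targetS-coeff m′ m′-even =
  trans (⊛-distribʳ-⊕ (quadratic ⊕ sine) (constS (fromℤ (+ 9))) secS m)
  (cong₂ ℚ._+_
    (trans (⊛-distribʳ-⊕ quadratic sine secS m)
      (cong₂ ℚ._+_
        (trans (⊛-·ₛ (fromℤ (+ 4)) (xS ⊛ xS) secS m)
               (cong (fromℤ (+ 4) ℚ.*_) (trans (xS-⊛-⊛-suc xS secS (suc m′)) (trans (xS-⊛-suc secS m′) (secS-coeff m′)))))
        (trans (⊛-·ₛ (ℚ.- fromℤ (+ 12)) (xS ⊛ sinS) secS m)
               (cong (ℚ.- fromℤ (+ 12) ℚ.*_) (trans (xS-⊛-⊛-suc sinS secS (suc m′)) (sinS⊛secS (suc m′) (cong not m′-even)))))))
    (trans (constS-⊛ (fromℤ (+ 9)) secS m) (cong (fromℤ (+ 9) ℚ.*_) (secS-coeff m))))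
  where
  m = 2 + m′
  quadratic sine : Series
  quadratic = fromℤ (+ 4) ·ₛ (xS ⊛ xS)
  sine = (ℚ.- fromℤ (+ 12)) ·ₛ (xS ⊛ sinS)

zigzagPolynomial : ℕ → ℤ → ℤ → ℤ → ℤ
zigzagPolynomial m′ a u b = + 4 ℤ.* (+ (2 + m′) ℤ.* + (1 + m′)) ℤ.* a ℤ.+ ℤ.- + 12 ℤ.* + (2 + m′) ℤ.* u ℤ.+ + 9 ℤ.* b

fromℤ-zigzagPolynomial : ∀ m′ a u b → fromℤ (zigzagPolynomial m′ a u b) ≡
  fromℤ (+ 4) ℚ.* (fromℤ (+ (2 + m′)) ℚ.* fromℤ (+ (1 + m′))) ℚ.* fromℤ a
    ℚ.+ ℚ.- fromℤ (+ 12) ℚ.* fromℤ (+ (2 + m′)) ℚ.* fromℤ u ℚ.+ fromℤ (+ 9) ℚ.* fromℤ b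
fromℤ-zigzagPolynomial m′ a u b = begin
  fromℤ (A ℤ.+ B ℤ.+ + 9 ℤ.* b)                       ≡⟨ fromℤ-+ (A ℤ.+ B) (+ 9 ℤ.* b) ⟩
  fromℤ (A ℤ.+ B) ℚ.+ fromℤ (+ 9 ℤ.* b)              ≡⟨ cong₂ ℚ._+_ (fromℤ-+ A B) (fromℤ-* (+ 9) b) ⟩
  fromℤ A ℚ.+ fromℤ B ℚ.+ fromℤ (+ 9) ℚ.* fromℤ b    ≡⟨ cong₂ (λ x y → x ℚ.+ y ℚ.+ fromℤ (+ 9) ℚ.* fromℤ b) A≡ B≡ ⟩
  fromℤ (+ 4) ℚ.* (fromℤ S₂ ℚ.* fromℤ S₁) ℚ.* fromℤ a ℚ.+ ℚ.- fromℤ (+ 12) ℚ.* fromℤ S₂ ℚ.* fromℤ u ℚ.+ fromℤ (+ 9) ℚ.* fromℤ b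
                                                      ∎
  where
  open ≡-Reasoning
  S₂ = + (2 + m′)
  S₁ = + (1 + m′)
  A = + 4 ℤ.* (S₂ ℤ.* S₁) ℤ.* a
  B = ℤ.- + 12 ℤ.* S₂ ℤ.* u
  A≡ : fromℤ A ≡ fromℤ (+ 4) ℚ.* (fromℤ S₂ ℚ.* fromℤ S₁) ℚ.* fromℤ a
  A≡ = trans (fromℤ-* (+ 4 ℤ.* (S₂ ℤ.* S₁)) a) (cong (ℚ._* fromℤ a) (trans (fromℤ-* (+ 4) (S₂ ℤ.* S₁)) (cong (fromℤ (+ 4) ℚ.*_) (fromℤ-* S₂ S₁))))
  B≡ : fromℤ B ≡ ℚ.- fromℤ (+ 12) ℚ.* fromℤ S₂ ℚ.* fromℤ u
  B≡ = trans (fromℤ-* (ℤ.- + 12 ℤ.* S₂) u) (cong (ℚ._* fromℤ u) (trans (fromℤ-* (ℤ.- + 12) S₂) (cong (ℚ._* fromℤ S₂) (fromℤ-neg (+ 12)))))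

factorial-suc-*-invFact : ∀ n → fromℤ (+ (suc n !)) ℚ.* invFact n ≡ fromℤ (+ suc n)
factorial-suc-*-invFact n = begin
  fromℤ (+ (suc n * n !)) ℚ.* invFact n               ≡⟨ cong (ℚ._* invFact n) (fromℤ-ℕ* (suc n) (n !)) ⟩
  fromℤ (+ suc n) ℚ.* fromℤ (+ (n !)) ℚ.* invFact n   ≡⟨ ℚₚ.*-assoc (fromℤ (+ suc n)) _ _ ⟩
  fromℤ (+ suc n) ℚ.* (fromℤ (+ (n !)) ℚ.* invFact n) ≡⟨ cong (fromℤ (+ suc n) ℚ.*_) (factorial-*-invFact n) ⟩
  fromℤ (+ suc n) ℚ.* 1ℚ                             ≡⟨ ℚₚ.*-identityʳ (fromℤ (+ suc n)) ⟩
  fromℤ (+ suc n)                                    ∎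
  where open ≡-Reasoning

factorial-2+-*-invFact : ∀ n → fromℤ (+ ((2 + n) !)) ℚ.* invFact n ≡ fromℤ (+ (2 + n)) ℚ.* fromℤ (+ (1 + n))
factorial-2+-*-invFact n = begin
  fromℤ (+ ((2 + n) * (1 + n) !)) ℚ.* invFact n                 ≡⟨ cong (ℚ._* invFact n) (fromℤ-ℕ* (2 + n) ((1 + n) !)) ⟩
  fromℤ (+ (2 + n)) ℚ.* fromℤ (+ ((1 + n) !)) ℚ.* invFact n      ≡⟨ ℚₚ.*-assoc (fromℤ (+ (2 + n))) _ _ ⟩
  fromℤ (+ (2 + n)) ℚ.* (fromℤ (+ ((1 + n) !)) ℚ.* invFact n)    ≡⟨ cong (fromℤ (+ (2 + n)) ℚ.*_) (factorial-suc-*-invFact n) ⟩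
  fromℤ (+ (2 + n)) ℚ.* fromℤ (+ (1 + n))                        ∎
  where open ≡-Reasoning

scale-by-factorial : ∀ m′ (a u b : ℤ) →
  fromℤ (+ ((2 + m′) !)) ℚ.*
    ((fromℤ (+ 4) ℚ.* (fromℤ a ℚ.* invFact m′) ℚ.+ ℚ.- fromℤ (+ 12) ℚ.* (fromℤ u ℚ.* invFact (1 + m′)))
      ℚ.+ fromℤ (+ 9) ℚ.* (fromℤ b ℚ.* invFact (2 + m′)))
  ≡ fromℤ (zigzagPolynomial m′ a u b)
scale-by-factorial m′ a u b = begin
  F ℚ.* ((c₄ ℚ.* (a′ ℚ.* i₀) ℚ.+ c₁₂ ℚ.* (u′ ℚ.* i₁)) ℚ.+ c₉ ℚ.* (b′ ℚ.* i₂))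
    ≡⟨ distribute F c₄ a′ i₀ c₁₂ u′ i₁ c₉ b′ i₂ ⟩
  c₄ ℚ.* (F ℚ.* i₀) ℚ.* a′ ℚ.+ c₁₂ ℚ.* (F ℚ.* i₁) ℚ.* u′ ℚ.+ c₉ ℚ.* (F ℚ.* i₂) ℚ.* b′
    ≡⟨ cong₂ (λ x y → c₄ ℚ.* x ℚ.* a′ ℚ.+ c₁₂ ℚ.* y ℚ.* u′ ℚ.+ c₉ ℚ.* (F ℚ.* i₂) ℚ.* b′)
             (factorial-2+-*-invFact m′) (factorial-suc-*-invFact (1 + m′)) ⟩
  c₄ ℚ.* (s₂ ℚ.* s₁) ℚ.* a′ ℚ.+ c₁₂ ℚ.* s₂ ℚ.* u′ ℚ.+ c₉ ℚ.* (F ℚ.* i₂) ℚ.* b′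
    ≡⟨ cong (λ z → c₄ ℚ.* (s₂ ℚ.* s₁) ℚ.* a′ ℚ.+ c₁₂ ℚ.* s₂ ℚ.* u′ ℚ.+ c₉ ℚ.* z ℚ.* b′)
            (trans (factorial-*-invFact (2 + m′)) (sym (ℚₚ.*-identityʳ 1ℚ))) ⟩
  c₄ ℚ.* (s₂ ℚ.* s₁) ℚ.* a′ ℚ.+ c₁₂ ℚ.* s₂ ℚ.* u′ ℚ.+ c₉ ℚ.* (1ℚ ℚ.* 1ℚ) ℚ.* b′
    ≡⟨ cong (λ z → c₄ ℚ.* (s₂ ℚ.* s₁) ℚ.* a′ ℚ.+ c₁₂ ℚ.* s₂ ℚ.* u′ ℚ.+ z ℚ.* b′) (trans (ℚₚ.*-identityʳ c₉) (ℚₚ.*-identityʳ c₉)) ⟩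
  c₄ ℚ.* (s₂ ℚ.* s₁) ℚ.* a′ ℚ.+ c₁₂ ℚ.* s₂ ℚ.* u′ ℚ.+ c₉ ℚ.* b′
    ≡⟨ fromℤ-zigzagPolynomial m′ a u b ⟨
  fromℤ (zigzagPolynomial m′ a u b)
    ∎
  where
  open ≡-Reasoning
  F = fromℤ (+ ((2 + m′) !))
  s₂ = fromℤ (+ (2 + m′))
  s₁ = fromℤ (+ (1 + m′))
  i₀ = invFact m′
  i₁ = invFact (1 + m′)
  i₂ = invFact (2 + m′)
  a′ = fromℤ a
  u′ = fromℤ u
  b′ = fromℤ b
  c₄ = fromℤ (+ 4)
  c₉ = fromℤ (+ 9)
  c₁₂ = ℚ.- fromℤ (+ 12)
  distribute : ∀ F c₄ a i₀ c₁₂ u i₁ c₉ b i₂ →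
    F ℚ.* ((c₄ ℚ.* (a ℚ.* i₀) ℚ.+ c₁₂ ℚ.* (u ℚ.* i₁)) ℚ.+ c₉ ℚ.* (b ℚ.* i₂))
      ≡ c₄ ℚ.* (F ℚ.* i₀) ℚ.* a ℚ.+ c₁₂ ℚ.* (F ℚ.* i₁) ℚ.* u ℚ.+ c₉ ℚ.* (F ℚ.* i₂) ℚ.* b
  distribute = solve 10 (λ F c₄ a i₀ c₁₂ u i₁ c₉ b i₂ →
      F :* ((c₄ :* (a :* i₀) :+ c₁₂ :* (u :* i₁)) :+ c₉ :* (b :* i₂))
        := c₄ :* (F :* i₀) :* a :+ c₁₂ :* (F :* i₁) :* u :+ c₉ :* (F :* i₂) :* b) refl
    where open ℚ-Solver

completions≡zigzag : ∀ n → completions (suc n) false (suc n) ≡ zigzag (suc n)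
completions≡zigzag n = trans (completions-false-suc n (suc n) ℕₚ.≤-refl)
  (trans (sym (alternating-suc n true z≤n)) (alternating-up≡down (suc n)))

targetS-formula : ∀ m′ → isEven m′ ≡ true →
  fromℤ (+ ((2 + m′) !)) *ℚ targetS (2 + m′) ≡ fromℤ (zigzagPolynomial m′ (+ zigzag m′) (+ zigzag (1 + m′)) (+ zigzag (2 + m′)))
targetS-formula m′ m′-even = begin
  fromℤ (+ ((2 + m′) !)) *ℚ targetS (2 + m′)
    ≡⟨ trans (cong (fromℤ (+ ((2 + m′) !)) *ℚ_) (targetS-coeff m′ m′-even))
             (scale-by-factorial m′ (secCoeff m′) (+ completions (1 + m′) false (1 + m′)) (secCoeff (2 + m′))) ⟩
  fromℤ (zigzagPolynomial m′ (secCoeff m′) (+ completions (1 + m′) false (1 + m′)) (secCoeff (2 + m′)))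
    ≡⟨ cong fromℤ (cong₂ (λ a b → zigzagPolynomial m′ a (+ completions (1 + m′) false (1 + m′)) b)
                         (secCoeff-even m′ m′-even) (secCoeff-even (2 + m′) (trans (isEven-+ 2 m′) m′-even))) ⟩
  fromℤ (zigzagPolynomial m′ (+ zigzag m′) (+ completions (1 + m′) false (1 + m′)) (+ zigzag (2 + m′)))
    ≡⟨ cong (λ u → fromℤ (zigzagPolynomial m′ (+ zigzag m′) (+ u) (+ zigzag (2 + m′)))) (completions≡zigzag m′) ⟩
  fromℤ (zigzagPolynomial m′ (+ zigzag m′) (+ zigzag (1 + m′)) (+ zigzag (2 + m′)))
    ∎
  where
  open ≡-Reasoning
  secCoeff-even : ∀ n → isEven n ≡ true → secCoeff n ≡ + zigzag n
  secCoeff-even n even rewrite even = refl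

-- The count of A^{3412}_{3412}(m)

cardAPQ≡prefixed : ∀ m → 4 ≤ m → isEven m ≡ true → cardAPQ m p3412 p3412 ≡ Suffix3412.prefixed m
cardAPQ≡prefixed m 4≤m m-even = countInjective-cong m m
  (λ xs → altFrom true xs ∧ (orderIso (take 4 xs) p3412 ∧ orderIso (drop (m ∸ 4) xs) p3412))
  (λ xs → altFrom true xs ∧ (fourth<first xs ∧ last<fourthLast xs))
  (λ w → both (altFrom true (values w)) (orderIso-take-3412 (values w) (4≤length w)) (suffix w))
  where
  4≤length : ∀ (w : Vec (Fin m) m) → 4 ≤ length (values w)
  4≤length w = subst (4 ≤_) (sym (length-values w)) 4≤m
  both : ∀ a {b b′ c c′} → a ∧ b ≡ a ∧ b′ → a ∧ c ≡ a ∧ c′ → a ∧ (b ∧ c) ≡ a ∧ (b′ ∧ c′)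
  both true  b≡ c≡ = cong₂ _∧_ b≡ c≡
  both false _  _  = refl
  suffix : ∀ (w : Vec (Fin m) m) →
    altFrom true (values w) ∧ orderIso (drop (m ∸ 4) (values w)) p3412 ≡ altFrom true (values w) ∧ last<fourthLast (values w)
  suffix w with orderIso-drop-3412 (values w) (4≤length w)
  ... | eq rewrite length-values w | m-even = eq

cast-recurrence : ∀ a c M P → a + 3 * c ≡ 2 * M * P → + a ℤ.+ + 3 ℤ.* + c ≡ + 2 ℤ.* + M ℤ.* + P
cast-recurrence a c M P eq = begin
  + a ℤ.+ + 3 ℤ.* + c        ≡⟨ cong (ℤ._+_ (+ a)) (ℤₚ.pos-* 3 c) ⟨
  + a ℤ.+ + (3 * c)          ≡⟨ ℤₚ.pos-+ a (3 * c) ⟨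
  + (a + 3 * c)              ≡⟨ cong +_ eq ⟩
  + (2 * M * P)              ≡⟨ trans (ℤₚ.pos-* (2 * M) P) (cong (ℤ._* + P) (ℤₚ.pos-* 2 M)) ⟩
  + 2 ℤ.* + M ℤ.* + P        ∎
  where open ≡-Reasoning

-- The conclusion is the combination h₁ - 3 h₂ + 2M h₃ of the hypotheses.
eliminate : ∀ C P₁ P₂ E₀ E₁ E₂ M M₁ →
  C ℤ.+ + 3 ℤ.* P₂ ≡ + 2 ℤ.* M ℤ.* P₁ →
  P₂ ℤ.+ + 3 ℤ.* E₂ ≡ + 2 ℤ.* M ℤ.* E₁ →
  P₁ ℤ.+ + 3 ℤ.* E₁ ≡ + 2 ℤ.* M₁ ℤ.* E₀ →
  C ≡ + 4 ℤ.* (M ℤ.* M₁) ℤ.* E₀ ℤ.+ ℤ.- + 12 ℤ.* M ℤ.* E₁ ℤ.+ + 9 ℤ.* E₂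
eliminate C P₁ P₂ E₀ E₁ E₂ M M₁ h₁ h₂ h₃ = begin
  C
    ≡⟨ combination C P₁ P₂ E₀ E₁ E₂ M M₁ ⟩
  R ℤ.+ (l₁ ℤ.- r₁) ℤ.- + 3 ℤ.* (l₂ ℤ.- r₂) ℤ.+ + 2 ℤ.* M ℤ.* (l₃ ℤ.- r₃)
    ≡⟨ cong₂ (λ x y → R ℤ.+ (x ℤ.- r₁) ℤ.- + 3 ℤ.* y ℤ.+ + 2 ℤ.* M ℤ.* (l₃ ℤ.- r₃)) h₁ (cong (ℤ._- r₂) h₂) ⟩
  R ℤ.+ (r₁ ℤ.- r₁) ℤ.- + 3 ℤ.* (r₂ ℤ.- r₂) ℤ.+ + 2 ℤ.* M ℤ.* (l₃ ℤ.- r₃)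
    ≡⟨ cong (λ x → R ℤ.+ (r₁ ℤ.- r₁) ℤ.- + 3 ℤ.* (r₂ ℤ.- r₂) ℤ.+ + 2 ℤ.* M ℤ.* (x ℤ.- r₃)) h₃ ⟩
  R ℤ.+ (r₁ ℤ.- r₁) ℤ.- + 3 ℤ.* (r₂ ℤ.- r₂) ℤ.+ + 2 ℤ.* M ℤ.* (r₃ ℤ.- r₃)
    ≡⟨ cancel R r₁ r₂ r₃ M ⟩
  R
    ∎
  where
  open ≡-Reasoning
  R = + 4 ℤ.* (M ℤ.* M₁) ℤ.* E₀ ℤ.+ ℤ.- + 12 ℤ.* M ℤ.* E₁ ℤ.+ + 9 ℤ.* E₂
  l₁ = C ℤ.+ + 3 ℤ.* P₂
  r₁ = + 2 ℤ.* M ℤ.* P₁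
  l₂ = P₂ ℤ.+ + 3 ℤ.* E₂
  r₂ = + 2 ℤ.* M ℤ.* E₁
  l₃ = P₁ ℤ.+ + 3 ℤ.* E₁
  r₃ = + 2 ℤ.* M₁ ℤ.* E₀
  combination : ∀ C P₁ P₂ E₀ E₁ E₂ M M₁ →
    C ≡ (+ 4 ℤ.* (M ℤ.* M₁) ℤ.* E₀ ℤ.+ ℤ.- + 12 ℤ.* M ℤ.* E₁ ℤ.+ + 9 ℤ.* E₂)
          ℤ.+ ((C ℤ.+ + 3 ℤ.* P₂) ℤ.- + 2 ℤ.* M ℤ.* P₁)
          ℤ.- + 3 ℤ.* ((P₂ ℤ.+ + 3 ℤ.* E₂) ℤ.- + 2 ℤ.* M ℤ.* E₁)
          ℤ.+ + 2 ℤ.* M ℤ.* ((P₁ ℤ.+ + 3 ℤ.* E₁) ℤ.- + 2 ℤ.* M₁ ℤ.* E₀)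
  combination = ℤ-Ring.solve-∀
  cancel : ∀ R r₁ r₂ r₃ M → R ℤ.+ (r₁ ℤ.- r₁) ℤ.- + 3 ℤ.* (r₂ ℤ.- r₂) ℤ.+ + 2 ℤ.* M ℤ.* (r₃ ℤ.- r₃) ≡ R
  cancel = ℤ-Ring.solve-∀

prefixed-recurrenceℤ : ∀ L → + prefixed (4 + L) ℤ.+ + 3 ℤ.* + zigzag (4 + L) ≡ + 2 ℤ.* + (4 + L) ℤ.* + zigzag (3 + L)
prefixed-recurrenceℤ L = cast-recurrence (prefixed (4 + L)) (zigzag (4 + L)) (4 + L) (zigzag (3 + L))
  (subst (λ x → prefixed (4 + L) + 3 * x ≡ 2 * (4 + L) * zigzag (3 + L))
         (alternating-up≡down (4 + L)) (Recurrence.prefixed-recurrence anySuffix L z≤n))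

cardAPQ-recurrence : ∀ L → 4 ≤ L → isEven L ≡ true →
  + cardAPQ (4 + L) p3412 p3412 ℤ.+ + 3 ℤ.* + prefixed (4 + L) ≡ + 2 ℤ.* + (4 + L) ℤ.* + prefixed (3 + L)
cardAPQ-recurrence L 4≤L L-even = cast-recurrence card (prefixed (4 + L)) (4 + L) (prefixed (3 + L)) (begin
  card + 3 * prefixed (4 + L)
    ≡⟨ cong₂ (λ c p → c + 3 * p) (cardAPQ≡prefixed (4 + L) 4≤4+L (trans (isEven-+ 4 L) L-even))
                                 (symmetric (4 + L) 4≤4+L (trans (isEven-+ 4 L) L-even)) ⟩
  Suffix3412.prefixed (4 + L) + 3 * Suffix3412.alternating (4 + L) true
    ≡⟨ Recurrence.prefixed-recurrence suffix3412 L 4≤L ⟩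
  2 * (4 + L) * Suffix3412.alternating (3 + L) false
    ≡⟨ cong (2 * (4 + L) *_) (sym (symmetric (3 + L) 4≤3+L (trans (isEven-+ 3 L) (cong not L-even)))) ⟩
  2 * (4 + L) * prefixed (3 + L)
    ∎)
  where
  open ≡-Reasoning
  card = cardAPQ (4 + L) p3412 p3412
  4≤4+L : 4 ≤ 4 + L
  4≤4+L = ℕₚ.m≤m+n 4 L
  4≤3+L : 4 ≤ 3 + L
  4≤3+L = ≤-trans 4≤L (ℕₚ.m≤n+m L 3)
  symmetric : ∀ N → 4 ≤ N → ∀ {e} → isEven N ≡ e → prefixed N ≡ Suffix3412.alternating N e
  symmetric N 4≤N refl = prefixed≡alternating-suffix3412 N 4≤N

cardAPQ-formula : ∀ L → 4 ≤ L → isEven L ≡ true →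
  + cardAPQ (4 + L) p3412 p3412 ≡ zigzagPolynomial (2 + L) (+ zigzag (2 + L)) (+ zigzag (3 + L)) (+ zigzag (4 + L))
cardAPQ-formula L@(suc L₁) 4≤L L-even =
  eliminate (+ cardAPQ (4 + L) p3412 p3412) (+ prefixed (3 + L)) (+ prefixed (4 + L))
            (+ zigzag (2 + L)) (+ zigzag (3 + L)) (+ zigzag (4 + L)) (+ (4 + L)) (+ (3 + L))
            (cardAPQ-recurrence L 4≤L L-even) (prefixed-recurrenceℤ L) (prefixed-recurrenceℤ L₁)

mainTheorem18 : (n : ℕ) → 4 ≤ n →
    (+ cardAPQ (2 * n) p3412 p3412) / 1
    ≡ ((+ ((2 * n) !)) / 1) *ℚ targetS (2 * n)
mainTheorem18 n 4≤n = subst (λ m → fromℤ (+ cardAPQ m p3412 p3412) ≡ fromℤ (+ (m !)) *ℚ targetS m) (sym 2n≡4+L)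
  (trans (cong fromℤ (cardAPQ-formula L 4≤L L-even)) (sym (targetS-formula (2 + L) (trans (isEven-+ 2 L) L-even))))
  where
  L = 2 * (n ∸ 2)
  2n≡4+L : 2 * n ≡ 4 + L
  2n≡4+L = trans (cong (2 *_) (sym (ℕₚ.m+[n∸m]≡n (≤-trans (ℕₚ.m≤m+n 2 2) 4≤n)))) (ℕₚ.*-distribˡ-+ 2 2 (n ∸ 2))
  4≤L : 4 ≤ L
  4≤L = ℕₚ.*-monoʳ-≤ 2 (ℕₚ.∸-monoˡ-≤ 2 4≤n)
  L-even : isEven L ≡ true
  L-even = isEven-2* (n ∸ 2)
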